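{- Let $q$ be a prime and $r, s$ integers with $3\leq r<s$ such that $1$, $r$, $s$ are pairwise incongruent modulo $q$. Let $a$ be the integer with $0<a<q$ and $a\equiv -(r-1)^{ -1}(s-1)\pmod q$ (so that $1\leq a\leq q-2$). For integers $n\geq 0$ define $$a_n=\sum_{\substack{ri+sj+k=n\\ i,j,k\geq 0}}\binom{a/q}{i}\binom{1/q}{j}\binom{ -(a+1)/q}{k}(-1)^{i+j+k},$$ so that $\sum_{n\ge 0} a_n x^{ -n}=(1-x^{ -r})^{a/q}(1-x^{ -s})^{1/q}(1-x^{ -1})^{ -(a+1)/q}$ as formal series in $x^{ -1}$. Then for every nonnegative integer $n$: $$\operatorname{ord}_q a_n=-n-\operatorname{ord}_q(n!),\qquad q^{\,n+\lfloor n/(q-1)\rfloor}a_n\in\mathbb{Z},$$ and $$|a_n|\leq\left(\lfloor n/r\rfloor+1\right)\left(\lfloor n/s\rfloor+1\right).$$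
   Context: $\binom{c}{i}=\frac{c(c-1)\cdots(c-i+1)}{i!}$ denotes the generalized binomial coefficient for rational $c$. $\operatorname{ord}_q$ is the $q$-adic valuation on $\mathbb{Q}$, and $\lfloor\cdot\rfloor$ is the integer part. -}

module Defs where

open import Data.Nat as ℕ using (ℕ; zero; suc; NonZero)
import Data.Nat.Properties as ℕP
open import Data.Nat.Divisibility using (_∣_)
open import Data.Integer as ℤ using (ℤ; +_; -[1+_])
open import Data.Rational as ℚ using (ℚ; _/_; 0ℚ; 1ℚ)
open import Data.List using (List; foldr; map; upTo)
open import Data.Product using (Σ; _×_)
open import Data.Bool using (if_then_else_)
open import Relation.Nullary using (¬_)
open import Relation.Binary.PropositionalEquality using (_≡_)

sumℚ : List ℚ → ℚ
sumℚ = foldr ℚ._+_ 0ℚ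

ℕ→ℚ : ℕ → ℚ
ℕ→ℚ n = (+ n) / 1

binom : ℚ → ℕ → ℚ
binom c zero    = 1ℚ
binom c (suc i) = binom c i ℚ.* ((c ℚ.- ℕ→ℚ i) ℚ.* ((+ 1) / suc i))

sgn : ℕ → ℚ
sgn zero    = 1ℚ
sgn (suc m) = ℚ.- sgn m

-- a_n = Σ_{r i + s j + k = n, i,j,k ≥ 0} binom(α,i) binom(β,j) binom(γ,k) (-1)^(i+j+k)
-- (i and j range over 0..n; k = n - r i - s j is determined when r i + s j ≤ n)
coeff : ℚ → ℚ → ℚ → ℕ → ℕ → ℕ → ℚ
coeff α β γ r s n =
  sumℚ (map (λ i → sumℚ (map (λ j →
    if (r ℕ.* i ℕ.+ s ℕ.* j) ℕ.≤ᵇ n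
    then (let k = n ℕ.∸ (r ℕ.* i ℕ.+ s ℕ.* j) in
          binom α i ℚ.* binom β j ℚ.* binom γ k ℚ.* sgn (i ℕ.+ j ℕ.+ k))
    else 0ℚ) (upTo (suc n)))) (upTo (suc n)))

qpow : (q : ℕ) .{{_ : NonZero q}} → ℤ → ℚ
qpow q (+ n)     = (+ (q ℕ.^ n)) / 1
qpow q -[1+ n ]  = _/_ (+ 1) (q ℕ.^ suc n) {{ℕP.m^n≢0 q (suc n)}}

-- IsOrd q x v : the q-adic valuation ord_q x of the rational x is v, i.e.
-- x = q^v · u/w with integers u, w, w > 0, q ∤ u, q ∤ w  (in particular x ≠ 0)
IsOrd : (q : ℕ) .{{_ : NonZero q}} → ℚ → ℤ → Set
IsOrd q x v = Σ ℤ λ u → Σ ℕ λ w →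
  (¬ (q ∣ ℤ.∣ u ∣)) × (¬ (q ∣ suc w)) × (x ≡ (u / suc w) ℚ.* qpow q v)

-- floor division ⌊n/d⌋ (only used with d > 0; the value at d = 0 is irrelevant)
fdiv : ℕ → ℕ → ℕ
fdiv n zero    = zero
fdiv n (suc d) = n ℕ./ suc d

module Submission where

-- For c = u/q one has  qⁱ i! binom(c, i) = u (u - q) ⋯ (u - (i-1) q) =: qfall q u i ∈ ℤ.
-- Hence, with M = qⁿ n!, the term (i, j, k) of M aₙ (r i + s j + k = n) is the integer
--   q^(n-i-j-k) · n!/(i! j! k!) · qfall q a i · qfall q 1 j · qfall q (-(a+1)) k · (-1)^(i+j+k),
-- so M aₙ = T ∈ ℤ (module Coefficient).  Three properties of T give the three claims:
--  * q ∤ T: every term except (0,0,n) has i + j + k < n, and that term is ≡ ±(a+1)ⁿ (mod q);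
--    so ord_q aₙ = -n - ord_q n!  (ord-transfer);
--  * μ ∣ T where n! = μ q^E, q ∤ μ: modulo μ the number q is invertible and every qfall q u i
--    is qⁱ i! times an integer; with Legendre's bound E ≤ n/(q-1) this makes
--    q^(n + ⌊n/(q-1)⌋) aₙ an integer  (integral-transfer);
--  * |qfall q u i| ≤ qⁱ i! for |u| ≤ q, so |T| ≤ M (⌊n/r⌋+1)(⌊n/s⌋+1)  (abs-transfer).

open import Defs

open import Data.Bool using (Bool; true; false; if_then_else_) renaming (T to True)
open import Data.Empty using (⊥-elim)
open import Data.Integer as ℤ using (ℤ; +_; -[1+_]; +[1+_]; 0ℤ; 1ℤ)
import Data.Integer.Properties as ℤP
import Data.Integer.Divisibility.Signed as ℤD
open ℤD using () renaming (_∣_ to _∣ℤ_)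
open import Data.List using (List; []; _∷_; foldr; map; upTo; applyUpTo)
open import Data.Nat as ℕ using (ℕ; zero; suc; NonZero; _≤_; _<_; _∸_; _+_; _*_; _^_; _!; z≤n; s≤s)
import Data.Nat.Properties as ℕP
import Data.Nat.DivMod as ℕD
import Data.Nat.Combinatorics as ℕC
import Data.Nat.Divisibility as ND
open ND using (_∣_; _∤_)
open import Data.Nat.Coprimality using (Coprime; coprime-Bézout)
open import Data.Nat.GCD using (module Bézout)
open import Data.Nat.Induction using (<-rec)
open import Data.Nat.Primality using (Prime; euclidsLemma; prime⇒irreducible; prime⇒nonTrivial)
open import Data.Product using (Σ; _×_; _,_; proj₁; proj₂)
open import Data.Rational as ℚ using (ℚ; _/_; 0ℚ; 1ℚ; toℚᵘ; mkℚ)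
import Data.Rational.Properties as ℚP
open import Data.Rational.Unnormalised as ℚᵘ using (mkℚᵘ; *≡*)
import Data.Rational.Unnormalised.Properties as ℚᵘP
open import Data.Sum using (inj₁; inj₂)
open import Level using (0ℓ)
open import Relation.Nullary using (¬_; yes; no)
open import Relation.Binary.PropositionalEquality
open import Data.Maybe using (nothing)
import Tactic.RingSolver as RingSolver
import Tactic.RingSolver.Core.AlmostCommutativeRing as ACR
open import Data.Nat.Tactic.RingSolver using () renaming (solve-∀ to ℕ-solve)
open import Data.Integer.Tactic.RingSolver using () renaming (solve-∀ to ℤ-solve)

ℚ-ring : ACR.AlmostCommutativeRing 0ℓ 0ℓ
ℚ-ring = ACR.fromCommutativeRing ℚP.+-*-commutativeRing (λ _ → nothing)

open RingSolver using (solve-∀)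

-- Integers as rationals.  Note that  ℕ→ℚ n  is definitionally  ℤ→ℚ (+ n).
ℤ→ℚ : ℤ → ℚ
ℤ→ℚ z = z / 1

private
  ℤ→ℚᵘ : ∀ z → toℚᵘ (ℤ→ℚ z) ℚᵘ.≃ mkℚᵘ z 0
  ℤ→ℚᵘ z = ℚP.toℚᵘ-fromℚᵘ (mkℚᵘ z 0)

  /→ℚᵘ : ∀ z d → toℚᵘ (z / suc d) ℚᵘ.≃ mkℚᵘ z d
  /→ℚᵘ z d = ℚP.toℚᵘ-fromℚᵘ (mkℚᵘ z d)

ℤ→ℚ-+ : ∀ x y → ℤ→ℚ (x ℤ.+ y) ≡ ℤ→ℚ x ℚ.+ ℤ→ℚ y
ℤ→ℚ-+ x y = ℚP.toℚᵘ-injective (ℚᵘP.≃-trans (ℤ→ℚᵘ (x ℤ.+ y)) (ℚᵘP.≃-trans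
  (*≡* (cross x y)) (ℚᵘP.≃-sym (ℚᵘP.≃-trans (ℚP.toℚᵘ-homo-+ (ℤ→ℚ x) (ℤ→ℚ y)) (ℚᵘP.+-cong (ℤ→ℚᵘ x) (ℤ→ℚᵘ y))))))
  where
  cross : ∀ x y → (x ℤ.+ y) ℤ.* 1ℤ ≡ (x ℤ.* 1ℤ ℤ.+ y ℤ.* 1ℤ) ℤ.* 1ℤ
  cross = ℤ-solve

ℤ→ℚ-* : ∀ x y → ℤ→ℚ (x ℤ.* y) ≡ ℤ→ℚ x ℚ.* ℤ→ℚ y
ℤ→ℚ-* x y = ℚP.toℚᵘ-injective (ℚᵘP.≃-trans (ℤ→ℚᵘ (x ℤ.* y)) (ℚᵘP.≃-sym
  (ℚᵘP.≃-trans (ℚP.toℚᵘ-homo-* (ℤ→ℚ x) (ℤ→ℚ y)) (ℚᵘP.*-cong (ℤ→ℚᵘ x) (ℤ→ℚᵘ y)))))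

ℤ→ℚ-neg : ∀ x → ℤ→ℚ (ℤ.- x) ≡ ℚ.- ℤ→ℚ x
ℤ→ℚ-neg x = ℚP.toℚᵘ-injective (ℚᵘP.≃-trans (ℤ→ℚᵘ (ℤ.- x))
  (ℚᵘP.≃-sym (ℚᵘP.≃-trans (ℚP.toℚᵘ-homo‿- (ℤ→ℚ x)) (ℚᵘP.-‿cong (ℤ→ℚᵘ x)))))

ℕ→ℚ-* : ∀ x y → ℕ→ℚ (x * y) ≡ ℕ→ℚ x ℚ.* ℕ→ℚ y
ℕ→ℚ-* x y = trans (cong ℤ→ℚ (ℤP.pos-* x y)) (ℤ→ℚ-* (+ x) (+ y))

/-*-denominator : ∀ z d .{{_ : NonZero d}} → (z / d) ℚ.* ℕ→ℚ d ≡ ℤ→ℚ z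
/-*-denominator z (suc d) = ℚP.toℚᵘ-injective (ℚᵘP.≃-trans (ℚP.toℚᵘ-homo-* (z / suc d) (ℕ→ℚ (suc d)))
  (ℚᵘP.≃-trans (ℚᵘP.*-cong (/→ℚᵘ z d) (ℤ→ℚᵘ (+ suc d))) (ℚᵘP.≃-trans (*≡* (cross z d)) (ℚᵘP.≃-sym (ℤ→ℚᵘ z)))))
  where
  cross : ∀ z d → (z ℤ.* + suc d) ℤ.* 1ℤ ≡ z ℤ.* + (suc d * 1)
  cross z d rewrite ℤP.*-identityʳ (z ℤ.* + suc d) | ℕP.*-identityʳ (suc d) = refl

pos-*₄ : ∀ a b c d → + (a * b * c * d) ≡ + a ℤ.* + b ℤ.* + c ℤ.* + d
pos-*₄ a b c d = trans (ℤP.pos-* (a * b * c) d) (cong (ℤ._* + d)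
  (trans (ℤP.pos-* (a * b) c) (cong (ℤ._* + c) (ℤP.pos-* a b))))

ℕ→ℚ-*₄ : ∀ a b c d → ℕ→ℚ (a * b * c * d) ≡ ℕ→ℚ a ℚ.* ℕ→ℚ b ℚ.* ℕ→ℚ c ℚ.* ℕ→ℚ d
ℕ→ℚ-*₄ a b c d = trans (cong ℤ→ℚ (pos-*₄ a b c d)) (trans (ℤ→ℚ-* (+ a ℤ.* + b ℤ.* + c) (+ d))
  (cong (ℚ._* ℕ→ℚ d) (trans (ℤ→ℚ-* (+ a ℤ.* + b) (+ c)) (cong (ℚ._* ℕ→ℚ c) (ℤ→ℚ-* (+ a) (+ b))))))

ℕ→ℚ-*-cancelˡ : ∀ m .{{_ : NonZero m}} x y → ℕ→ℚ m ℚ.* x ≡ ℕ→ℚ m ℚ.* y → x ≡ y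
ℕ→ℚ-*-cancelˡ m x y eq = begin
    x                          ≡⟨ lemma x ⟩
    m⁻¹ ℚ.* (ℕ→ℚ m ℚ.* x)      ≡⟨ cong (m⁻¹ ℚ.*_) eq ⟩
    m⁻¹ ℚ.* (ℕ→ℚ m ℚ.* y)      ≡⟨ lemma y ⟨
    y                          ∎
  where
  open ≡-Reasoning
  m⁻¹ : ℚ
  m⁻¹ = (+ 1) / m
  lemma : ∀ z → z ≡ m⁻¹ ℚ.* (ℕ→ℚ m ℚ.* z)
  lemma z = begin
    z                          ≡⟨ ℚP.*-identityˡ z ⟨
    1ℚ ℚ.* z                   ≡⟨ cong (ℚ._* z) (/-*-denominator (+ 1) m) ⟨
    (m⁻¹ ℚ.* ℕ→ℚ m) ℚ.* z      ≡⟨ ℚP.*-assoc m⁻¹ (ℕ→ℚ m) z ⟩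
    m⁻¹ ℚ.* (ℕ→ℚ m ℚ.* z)      ∎

private
  ℤ→ℚ-canonical : ∀ z → ℤ→ℚ z ≡ mkℚ z 0 (λ (_ , d∣1) → ND.∣1⇒≡1 d∣1)
  ℤ→ℚ-canonical z = ℚP.↥p/↧p≡p (mkℚ z 0 (λ (_ , d∣1) → ND.∣1⇒≡1 d∣1))

ℤ→ℚ-mono-≤ : ∀ {x y} → x ℤ.≤ y → ℤ→ℚ x ℚ.≤ ℤ→ℚ y
ℤ→ℚ-mono-≤ {x} {y} x≤y rewrite ℤ→ℚ-canonical x | ℤ→ℚ-canonical y = ℚ.*≤* (ℤP.*-monoʳ-≤-nonNeg (+ 1) x≤y)

ℤ→ℚ-∣∣ : ∀ z → ℚ.∣ ℤ→ℚ z ∣ ≡ ℕ→ℚ ℤ.∣ z ∣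
ℤ→ℚ-∣∣ z rewrite ℤ→ℚ-canonical z | ℤ→ℚ-canonical (+ ℤ.∣ z ∣) = refl

ℕ→ℚ-positive : ∀ m .{{_ : NonZero m}} → ℚ.Positive (ℕ→ℚ m)
ℕ→ℚ-positive (suc m) rewrite ℤ→ℚ-canonical (+ suc m) = _

sumℤ : List ℤ → ℤ
sumℤ = foldr ℤ._+_ 0ℤ

sumℕ : List ℕ → ℕ
sumℕ = foldr _+_ 0

sum-scale-ℤ→ℚ : ∀ {A : Set} (K : ℚ) (f : A → ℚ) (g : A → ℤ) →
  (∀ x → K ℚ.* f x ≡ ℤ→ℚ (g x)) → ∀ l → K ℚ.* sumℚ (map f l) ≡ ℤ→ℚ (sumℤ (map g l))
sum-scale-ℤ→ℚ K f g h [] = ℚP.*-zeroʳ K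
sum-scale-ℤ→ℚ K f g h (x ∷ l) = begin
  K ℚ.* (f x ℚ.+ sumℚ (map f l))               ≡⟨ ℚP.*-distribˡ-+ K (f x) (sumℚ (map f l)) ⟩
  K ℚ.* f x ℚ.+ K ℚ.* sumℚ (map f l)           ≡⟨ cong₂ ℚ._+_ (h x) (sum-scale-ℤ→ℚ K f g h l) ⟩
  ℤ→ℚ (g x) ℚ.+ ℤ→ℚ (sumℤ (map g l))          ≡⟨ ℤ→ℚ-+ (g x) (sumℤ (map g l)) ⟨
  ℤ→ℚ (g x ℤ.+ sumℤ (map g l))                ∎
  where open ≡-Reasoning

∣sumℤ∣≤sumℕ∣∣ : ∀ {A : Set} (g : A → ℤ) l → ℤ.∣ sumℤ (map g l) ∣ ≤ sumℕ (map (λ x → ℤ.∣ g x ∣) l)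
∣sumℤ∣≤sumℕ∣∣ g [] = z≤n
∣sumℤ∣≤sumℕ∣∣ g (x ∷ l) = ℕP.≤-trans (ℤP.∣i+j∣≤∣i∣+∣j∣ (g x) (sumℤ (map g l)))
  (ℕP.+-monoʳ-≤ ℤ.∣ g x ∣ (∣sumℤ∣≤sumℕ∣∣ g l))

sumℕ-mono-≤ : ∀ {A : Set} {f g : A → ℕ} → (∀ x → f x ≤ g x) → ∀ l → sumℕ (map f l) ≤ sumℕ (map g l)
sumℕ-mono-≤ f≤g [] = z≤n
sumℕ-mono-≤ f≤g (x ∷ l) = ℕP.+-mono-≤ (f≤g x) (sumℕ-mono-≤ f≤g l)

sumℕ-*ˡ : ∀ {A : Set} (K : ℕ) (f : A → ℕ) l → sumℕ (map (λ x → K * f x) l) ≡ K * sumℕ (map f l)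
sumℕ-*ˡ K f [] = sym (ℕP.*-zeroʳ K)
sumℕ-*ˡ K f (x ∷ l) = trans (cong (λ z → K * f x + z) (sumℕ-*ˡ K f l)) (sym (ℕP.*-distribˡ-+ K (f x) _))

sumℕ-separable : ∀ {A B : Set} (f : A → ℕ) (g : B → ℕ) l₁ l₂ →
  sumℕ (map (λ i → sumℕ (map (λ j → f i * g j) l₂)) l₁) ≡ sumℕ (map f l₁) * sumℕ (map g l₂)
sumℕ-separable f g [] l₂ = refl
sumℕ-separable f g (i ∷ l₁) l₂ =
  trans (cong₂ _+_ (sumℕ-*ˡ (f i) g l₂) (sumℕ-separable f g l₁ l₂)) (sym (ℕP.*-distribʳ-+ _ (f i) _))

∣-sumℤ : ∀ (d : ℤ) (h : ℕ → ℤ) (f : ℕ → ℕ) N → (∀ t → d ∣ℤ h (f t)) → d ∣ℤ sumℤ (map h (applyUpTo f N))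
∣-sumℤ d h f zero      d∣ = ℤD.divides 0ℤ (sym (ℤP.*-zeroˡ d))
∣-sumℤ d h f (suc N)   d∣ = ℤD.∣m∣n⇒∣m+n (d∣ 0) (∣-sumℤ d h (λ t → f (suc t)) N (λ t → d∣ (suc t)))

𝟙 : Bool → ℕ
𝟙 true  = 1
𝟙 false = 0

𝟙-≤ᵇ : ∀ {x y} → x ≤ y → 𝟙 (x ℕ.≤ᵇ y) ≡ 1
𝟙-≤ᵇ {x} {y} x≤y with x ℕ.≤ᵇ y | ℕP.≤⇒≤ᵇ x≤y
... | true | _ = refl

count-multiples : ∀ d .{{_ : NonZero d}} n N c (f : ℕ → ℕ) → (∀ t → f t ≡ c + t) →
  sumℕ (map (λ x → 𝟙 (d * x ℕ.≤ᵇ n)) (applyUpTo f N)) ≤ (n ℕ./ d + 1) ∸ c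
count-multiples d n zero c f f≡ = z≤n
count-multiples d n (suc N) c f f≡ rewrite trans (f≡ 0) (ℕP.+-identityʳ c) with d * c ℕ.≤ᵇ n in eq
... | true  = ℕP.≤-trans (ℕP.+-monoʳ-≤ 1 rest) (ℕP.≤-reflexive (sym (ℕP.+-∸-assoc 1 c<⌊n/d⌋+1)))
  where
  rest = count-multiples d n N (suc c) (λ t → f (suc t)) (λ t → trans (f≡ (suc t)) (ℕP.+-suc c t))
  c≤⌊n/d⌋ : c ≤ n ℕ./ d
  c≤⌊n/d⌋ = subst (_≤ n ℕ./ d) (ℕD.m*n/n≡m c d)
    (ℕD./-monoˡ-≤ d (subst (_≤ n) (ℕP.*-comm d c) (ℕP.≤ᵇ⇒≤ (d * c) n (subst True (sym eq) _))))
  c<⌊n/d⌋+1 : suc c ≤ n ℕ./ d + 1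
  c<⌊n/d⌋+1 = subst (suc c ≤_) (ℕP.+-comm 1 (n ℕ./ d)) (s≤s c≤⌊n/d⌋)
... | false = ℕP.≤-trans (count-multiples d n N (suc c) (λ t → f (suc t)) (λ t → trans (f≡ (suc t)) (ℕP.+-suc c t)))
                (ℕP.∸-monoʳ-≤ (n ℕ./ d + 1) (ℕP.n≤1+n c))

ℤ-minus-plus : ∀ x y → x ℤ.- y ℤ.+ y ≡ x
ℤ-minus-plus = ℤ-solve

∣-*-congruence : ∀ μ x x′ y y′ → μ ∣ℤ (x ℤ.- x′) → μ ∣ℤ (y ℤ.- y′) → μ ∣ℤ (x ℤ.* y ℤ.- x′ ℤ.* y′)
∣-*-congruence μ x x′ y y′ μ∣x-x′ μ∣y-y′ = subst (μ ∣ℤ_) (sym (split x x′ y y′))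
  (ℤD.∣m∣n⇒∣m+n (ℤD.∣m⇒∣m*n y μ∣x-x′) (ℤD.∣n⇒∣m*n x′ μ∣y-y′))
  where
  split : ∀ x x′ y y′ → x ℤ.* y ℤ.- x′ ℤ.* y′ ≡ (x ℤ.- x′) ℤ.* y ℤ.+ x′ ℤ.* (y ℤ.- y′)
  split = ℤ-solve

∣-congruence-refl : ∀ μ x → μ ∣ℤ (x ℤ.- x)
∣-congruence-refl μ x = ℤD.divides 0ℤ (trans (ℤP.+-inverseʳ x) (sym (ℤP.*-zeroˡ μ)))

fall : ℤ → ℕ → ℤ
fall x zero    = 1ℤ
fall x (suc i) = fall x i ℤ.* (x ℤ.- + i)

fall-pascal : ∀ x i → fall (x ℤ.+ 1ℤ) (suc i) ≡ fall x (suc i) ℤ.+ (1ℤ ℤ.+ + i) ℤ.* fall x i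
fall-pascal x zero = shift x
  where
  shift : ∀ x → 1ℤ ℤ.* (x ℤ.+ 1ℤ ℤ.- 0ℤ) ≡ 1ℤ ℤ.* (x ℤ.- 0ℤ) ℤ.+ (1ℤ ℤ.+ 0ℤ) ℤ.* 1ℤ
  shift = ℤ-solve
fall-pascal x (suc i) = begin
  fall (x ℤ.+ 1ℤ) (suc i) ℤ.* (x ℤ.+ 1ℤ ℤ.- + suc i)
    ≡⟨ cong (ℤ._* (x ℤ.+ 1ℤ ℤ.- + suc i)) (fall-pascal x i) ⟩
  (fall x (suc i) ℤ.+ (1ℤ ℤ.+ + i) ℤ.* fall x i) ℤ.* (x ℤ.+ 1ℤ ℤ.- (1ℤ ℤ.+ + i))
    ≡⟨ expand (fall x i) x (+ i) ⟩
  fall x (suc i) ℤ.* (x ℤ.- (1ℤ ℤ.+ + i)) ℤ.+ (1ℤ ℤ.+ (1ℤ ℤ.+ + i)) ℤ.* fall x (suc i) ∎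
  where
  open ≡-Reasoning
  expand : ∀ F x I → (F ℤ.* (x ℤ.- I) ℤ.+ (1ℤ ℤ.+ I) ℤ.* F) ℤ.* (x ℤ.+ 1ℤ ℤ.- (1ℤ ℤ.+ I))
                   ≡ F ℤ.* (x ℤ.- I) ℤ.* (x ℤ.- (1ℤ ℤ.+ I)) ℤ.+ (1ℤ ℤ.+ (1ℤ ℤ.+ I)) ℤ.* (F ℤ.* (x ℤ.- I))
  expand = ℤ-solve

-- i! divides the falling factorial of every natural number (binomial coefficients are integers).
i!∣fall : ∀ N i → + (i !) ∣ℤ fall (+ N) i
i!∣fall N zero = ℤD.∣-refl
i!∣fall zero (suc i) = subst (+ (suc i !) ∣ℤ_) (sym (fall0 i)) (ℤD.divides 0ℤ refl)
  where
  fall0 : ∀ i → fall 0ℤ (suc i) ≡ 0ℤ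
  fall0 zero = refl
  fall0 (suc i) rewrite fall0 i = refl
i!∣fall (suc N) (suc i) =
  subst (λ z → + (suc i !) ∣ℤ fall z (suc i)) (cong +_ (ℕP.+-comm N 1))
    (subst (+ (suc i !) ∣ℤ_) (sym (fall-pascal (+ N) i))
      (ℤD.∣m∣n⇒∣m+n (i!∣fall N (suc i))
        (subst (_∣ℤ ((1ℤ ℤ.+ + i) ℤ.* fall (+ N) i)) (sym (ℤP.pos-* (suc i) (i !)))
          (ℤD.*-monoʳ-∣ (+ suc i) (i!∣fall N i)))))

-- The product  u (u - q) (u - 2q) ⋯ (u - (i-1) q)  =  qⁱ · (u/q)(u/q - 1)⋯(u/q - i + 1).
qfall : ℕ → ℤ → ℕ → ℤ
qfall q u zero    = 1ℤ
qfall q u (suc i) = qfall q u i ℤ.* (u ℤ.- + (i * q))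

binom-qfall : ∀ q .{{_ : NonZero q}} (c : ℚ) (u : ℤ) → c ℚ.* ℕ→ℚ q ≡ ℤ→ℚ u →
  ∀ i → ℕ→ℚ (q ^ i * i !) ℚ.* binom c i ≡ ℤ→ℚ (qfall q u i)
binom-qfall q c u cq≡u zero = refl
binom-qfall q c u cq≡u (suc i) = begin
    ℕ→ℚ (q * q ^ i * (suc i * i !)) ℚ.* (binom c i ℚ.* ((c ℚ.- ℕ→ℚ i) ℚ.* h))
      ≡⟨ cong (ℚ._* (binom c i ℚ.* ((c ℚ.- ℕ→ℚ i) ℚ.* h))) (ℕ→ℚ-split q (q ^ i) (suc i) (i !)) ⟩
    (ℕ→ℚ q ℚ.* ℕ→ℚ (q ^ i)) ℚ.* (ℕ→ℚ (suc i) ℚ.* ℕ→ℚ (i !)) ℚ.* (binom c i ℚ.* ((c ℚ.- ℕ→ℚ i) ℚ.* h))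
      ≡⟨ regroup (ℕ→ℚ q) (ℕ→ℚ (q ^ i)) (ℕ→ℚ (suc i)) (ℕ→ℚ (i !)) (binom c i) c (ℕ→ℚ i) h ⟩
    ((ℕ→ℚ (q ^ i) ℚ.* ℕ→ℚ (i !)) ℚ.* binom c i) ℚ.* (c ℚ.* ℕ→ℚ q ℚ.- ℕ→ℚ i ℚ.* ℕ→ℚ q) ℚ.* (h ℚ.* ℕ→ℚ (suc i))
      ≡⟨ cong₂ (λ z w → z ℚ.* (c ℚ.* ℕ→ℚ q ℚ.- w) ℚ.* (h ℚ.* ℕ→ℚ (suc i)))
           (trans (cong (ℚ._* binom c i) (sym (ℕ→ℚ-* (q ^ i) (i !)))) (binom-qfall q c u cq≡u i)) (sym (ℕ→ℚ-* i q)) ⟩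
    ℤ→ℚ (qfall q u i) ℚ.* (c ℚ.* ℕ→ℚ q ℚ.- ℕ→ℚ (i * q)) ℚ.* (h ℚ.* ℕ→ℚ (suc i))
      ≡⟨ cong₂ (λ z w → ℤ→ℚ (qfall q u i) ℚ.* (z ℚ.- ℕ→ℚ (i * q)) ℚ.* w) cq≡u (/-*-denominator (+ 1) (suc i)) ⟩
    ℤ→ℚ (qfall q u i) ℚ.* (ℤ→ℚ u ℚ.- ℕ→ℚ (i * q)) ℚ.* 1ℚ
      ≡⟨ ℚP.*-identityʳ _ ⟩
    ℤ→ℚ (qfall q u i) ℚ.* (ℤ→ℚ u ℚ.+ ℚ.- ℕ→ℚ (i * q))
      ≡⟨ cong (λ z → ℤ→ℚ (qfall q u i) ℚ.* z)
           (trans (cong (ℤ→ℚ u ℚ.+_) (sym (ℤ→ℚ-neg (+ (i * q))))) (sym (ℤ→ℚ-+ u (ℤ.- + (i * q))))) ⟩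
    ℤ→ℚ (qfall q u i) ℚ.* ℤ→ℚ (u ℤ.- + (i * q))
      ≡⟨ ℤ→ℚ-* (qfall q u i) (u ℤ.- + (i * q)) ⟨
    ℤ→ℚ (qfall q u (suc i)) ∎
  where
  open ≡-Reasoning
  h : ℚ
  h = (+ 1) / suc i
  ℕ→ℚ-split : ∀ a b c d → ℕ→ℚ (a * b * (c * d)) ≡ (ℕ→ℚ a ℚ.* ℕ→ℚ b) ℚ.* (ℕ→ℚ c ℚ.* ℕ→ℚ d)
  ℕ→ℚ-split a b c d = trans (ℕ→ℚ-* (a * b) (c * d)) (cong₂ ℚ._*_ (ℕ→ℚ-* a b) (ℕ→ℚ-* c d))
  regroup : ∀ A B S F X c I h → (A ℚ.* B) ℚ.* (S ℚ.* F) ℚ.* (X ℚ.* ((c ℚ.- I) ℚ.* h))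
                             ≡ ((B ℚ.* F) ℚ.* X) ℚ.* (c ℚ.* A ℚ.- I ℚ.* A) ℚ.* (h ℚ.* S)
  regroup = solve-∀ ℚ-ring

qfall-≡-fall : ∀ q (μ u : ℤ) N → μ ∣ℤ (+ q ℤ.* + N ℤ.- u) →
  ∀ i → μ ∣ℤ (qfall q u i ℤ.- + (q ^ i) ℤ.* fall (+ N) i)
qfall-≡-fall q μ u N μ∣qN-u zero = ℤD.divides 0ℤ (sym (ℤP.*-zeroˡ μ))
qfall-≡-fall q μ u N μ∣qN-u (suc i) =
  subst (μ ∣ℤ_) (sym step) (ℤD.∣m∣n⇒∣m+n
    (ℤD.∣m⇒∣m*n (u ℤ.- + i ℤ.* + q) (qfall-≡-fall q μ u N μ∣qN-u i))
    (ℤD.∣n⇒∣m*n (+ (q ^ i) ℤ.* fall (+ N) i) (ℤD.∣m⇒∣-m μ∣qN-u)))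
  where
  open ≡-Reasoning
  expand : ∀ A Qi F u I Q N → A ℤ.* (u ℤ.- I ℤ.* Q) ℤ.- Q ℤ.* Qi ℤ.* (F ℤ.* (N ℤ.- I))
           ≡ (A ℤ.- Qi ℤ.* F) ℤ.* (u ℤ.- I ℤ.* Q) ℤ.+ Qi ℤ.* F ℤ.* ℤ.- (Q ℤ.* N ℤ.- u)
  expand = ℤ-solve
  step : qfall q u (suc i) ℤ.- + (q ^ suc i) ℤ.* fall (+ N) (suc i)
       ≡ (qfall q u i ℤ.- + (q ^ i) ℤ.* fall (+ N) i) ℤ.* (u ℤ.- + i ℤ.* + q)
         ℤ.+ + (q ^ i) ℤ.* fall (+ N) i ℤ.* ℤ.- (+ q ℤ.* + N ℤ.- u)
  step = begin
    qfall q u i ℤ.* (u ℤ.- + (i * q)) ℤ.- + (q * q ^ i) ℤ.* (fall (+ N) i ℤ.* (+ N ℤ.- + i))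
      ≡⟨ cong₂ (λ x y → qfall q u i ℤ.* (u ℤ.- x) ℤ.- y ℤ.* (fall (+ N) i ℤ.* (+ N ℤ.- + i)))
           (ℤP.pos-* i q) (ℤP.pos-* q (q ^ i)) ⟩
    qfall q u i ℤ.* (u ℤ.- + i ℤ.* + q) ℤ.- + q ℤ.* + (q ^ i) ℤ.* (fall (+ N) i ℤ.* (+ N ℤ.- + i))
      ≡⟨ expand (qfall q u i) (+ (q ^ i)) (fall (+ N) i) u (+ i) (+ q) (+ N) ⟩
    _ ∎

-- Hence, modulo such μ, qfall q u i is qⁱ i! times an integer (namely the binomial coefficient of N).
qfall-≡-i!-multiple : ∀ q (μ u : ℤ) N → μ ∣ℤ (+ q ℤ.* + N ℤ.- u) →
  ∀ i → Σ ℤ λ y → μ ∣ℤ (qfall q u i ℤ.- + (q ^ i * i !) ℤ.* y)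
qfall-≡-i!-multiple q μ u N μ∣qN-u i with i!∣fall N i
... | ℤD.divides y fall≡y·i! = y , subst (λ z → μ ∣ℤ (qfall q u i ℤ.- z)) fall≡ (qfall-≡-fall q μ u N μ∣qN-u i)
  where
  open ≡-Reasoning
  fall≡ : + (q ^ i) ℤ.* fall (+ N) i ≡ + (q ^ i * i !) ℤ.* y
  fall≡ = begin
    + (q ^ i) ℤ.* fall (+ N) i        ≡⟨ cong (+ (q ^ i) ℤ.*_) fall≡y·i! ⟩
    + (q ^ i) ℤ.* (y ℤ.* + (i !))     ≡⟨ cong (+ (q ^ i) ℤ.*_) (ℤP.*-comm y (+ (i !))) ⟩
    + (q ^ i) ℤ.* (+ (i !) ℤ.* y)     ≡⟨ ℤP.*-assoc (+ (q ^ i)) (+ (i !)) y ⟨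
    + (q ^ i) ℤ.* + (i !) ℤ.* y       ≡⟨ cong (ℤ._* y) (ℤP.pos-* (q ^ i) (i !)) ⟨
    + (q ^ i * i !) ℤ.* y             ∎

qfall-bound : ∀ q u → ℤ.∣ u ∣ ≤ q → ∀ i → ℤ.∣ qfall q u i ∣ ≤ q ^ i * i !
qfall-bound q u ∣u∣≤q zero = ℕP.≤-refl
qfall-bound q u ∣u∣≤q (suc i) = begin
    ℤ.∣ qfall q u i ℤ.* (u ℤ.- + (i * q)) ∣     ≡⟨ ℤP.abs-* (qfall q u i) (u ℤ.- + (i * q)) ⟩
    ℤ.∣ qfall q u i ∣ * ℤ.∣ u ℤ.- + (i * q) ∣   ≤⟨ ℕP.*-mono-≤ (qfall-bound q u ∣u∣≤q i) ∣u-iq∣≤ ⟩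
    q ^ i * i ! * (q + i * q)                  ≡⟨ regroup (q ^ i) (i !) q i ⟩
    q * q ^ i * (i ! + i * i !)                ∎
  where
  open ℕP.≤-Reasoning
  ∣u-iq∣≤ : ℤ.∣ u ℤ.- + (i * q) ∣ ≤ q + i * q
  ∣u-iq∣≤ = ℕP.≤-trans (ℤP.∣i-j∣≤∣i∣+∣j∣ u (+ (i * q))) (ℕP.+-monoˡ-≤ (i * q) ∣u∣≤q)
  regroup : ∀ Qi F Q i → Qi * F * (Q + i * Q) ≡ Q * Qi * (F + i * F)
  regroup = ℕ-solve

divide-mod : ∀ q μ .{{_ : NonZero μ}} → Coprime q μ → ∀ u → Σ ℕ λ N → + μ ∣ℤ (+ q ℤ.* + N ℤ.- u)
divide-mod q μ@(suc μ-1) q⊥μ u with inverse q⊥μ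
  where
  inverse : Coprime q μ → Σ ℤ λ X → + μ ∣ℤ (+ q ℤ.* X ℤ.- 1ℤ)
  inverse q⊥μ with coprime-Bézout q⊥μ
  ... | Bézout.+- x y eq = + x , ℤD.divides (+ y) (begin
        + q ℤ.* + x ℤ.- 1ℤ             ≡⟨ cong (ℤ._- 1ℤ) (trans (ℤP.*-comm (+ q) (+ x)) (sym (ℤP.pos-* x q))) ⟩
        + (x * q) ℤ.- 1ℤ               ≡⟨ cong (λ z → + z ℤ.- 1ℤ) (sym eq) ⟩
        + (1 + y * μ) ℤ.- 1ℤ           ≡⟨ cong (ℤ._- 1ℤ) (trans (ℤP.pos-+ 1 (y * μ)) (cong (λ z → 1ℤ ℤ.+ z) (ℤP.pos-* y μ))) ⟩
        1ℤ ℤ.+ + y ℤ.* + μ ℤ.- 1ℤ      ≡⟨ cancel (+ y ℤ.* + μ) ⟩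
        + y ℤ.* + μ                    ∎)
    where
    open ≡-Reasoning
    cancel : ∀ b → 1ℤ ℤ.+ b ℤ.- 1ℤ ≡ b
    cancel = ℤ-solve
  ... | Bézout.-+ x y eq = ℤ.- (+ x) , ℤD.divides (ℤ.- (+ y)) (begin
        + q ℤ.* ℤ.- (+ x) ℤ.- 1ℤ       ≡⟨ rearrange (+ q) (+ x) ⟩
        ℤ.- (1ℤ ℤ.+ + x ℤ.* + q)       ≡⟨ cong (λ z → ℤ.- (1ℤ ℤ.+ z)) (sym (ℤP.pos-* x q)) ⟩
        ℤ.- (+ (1 + x * q))            ≡⟨ cong (λ z → ℤ.- (+ z)) eq ⟩
        ℤ.- (+ (y * μ))                ≡⟨ cong ℤ.-_ (ℤP.pos-* y μ) ⟩
        ℤ.- (+ y ℤ.* + μ)              ≡⟨ ℤP.neg-distribˡ-* (+ y) (+ μ) ⟩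
        ℤ.- (+ y) ℤ.* + μ              ∎)
    where
    open ≡-Reasoning
    rearrange : ∀ Q X → Q ℤ.* ℤ.- X ℤ.- 1ℤ ≡ ℤ.- (1ℤ ℤ.+ X ℤ.* Q)
    rearrange = ℤ-solve
... | X , μ∣qX-1 with lift (X ℤ.* u)
  where
  lift : ∀ z → Σ ℕ λ N → + μ ∣ℤ (+ N ℤ.- z)
  lift (+ k)     = k , ℤD.divides 0ℤ (ℤP.+-inverseʳ (+ k))
  lift -[1+ k ]  = μ-1 * suc k , ℤD.divides (+ suc k)
    (trans (cong +_ (regroup μ-1 k)) (sym (ℤP.pos-* (suc k) (suc μ-1))))
    where
    regroup : ∀ μ-1 k → μ-1 * suc k + suc k ≡ suc k * suc μ-1
    regroup = ℕ-solve
... | N , μ∣N-Xu = N , subst (+ μ ∣ℤ_) (sym (combine (+ q) (+ N) X u))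
        (ℤD.∣m∣n⇒∣m+n (ℤD.∣n⇒∣m*n (+ q) μ∣N-Xu) (ℤD.∣m⇒∣m*n u μ∣qX-1))
  where
  combine : ∀ Q N X u → Q ℤ.* N ℤ.- u ≡ Q ℤ.* (N ℤ.- X ℤ.* u) ℤ.+ (Q ℤ.* X ℤ.- 1ℤ) ℤ.* u
  combine = ℤ-solve

module PrimeFacts (q : ℕ) (q-prime : Prime q) where

  1<q : 1 < q
  1<q = ℕ.nonTrivial⇒n>1 q {{prime⇒nonTrivial q-prime}}

  q∤1 : q ∤ 1
  q∤1 q∣1 = ℕP.<⇒≢ 1<q (sym (ND.∣1⇒≡1 q∣1))

  q∤* : ∀ {x y} → q ∤ x → q ∤ y → q ∤ x * y
  q∤* {x} {y} q∤x q∤y q∣xy with euclidsLemma x y q-prime q∣xy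
  ... | inj₁ q∣x = q∤x q∣x
  ... | inj₂ q∣y = q∤y q∣y

  q∤∣*∣ : ∀ {x y} → q ∤ ℤ.∣ x ∣ → q ∤ ℤ.∣ y ∣ → q ∤ ℤ.∣ x ℤ.* y ∣
  q∤∣*∣ {x} {y} q∤x q∤y = subst (q ∤_) (sym (ℤP.abs-* x y)) (q∤* q∤x q∤y)

  ∤⇒coprime : ∀ {μ} → q ∤ μ → Coprime q μ
  ∤⇒coprime q∤μ (d∣q , d∣μ) with prime⇒irreducible q-prime d∣q
  ... | inj₁ d≡1 = d≡1
  ... | inj₂ refl = ⊥-elim (q∤μ d∣μ)

  -- Every factor  u - t q  of qfall q u i is ≡ u (mod q).
  qfall-∤ : ∀ u → q ∤ ℤ.∣ u ∣ → ∀ i → q ∤ ℤ.∣ qfall q u i ∣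
  qfall-∤ u q∤u zero    = q∤1
  qfall-∤ u q∤u (suc i) = q∤∣*∣ {qfall q u i} (qfall-∤ u q∤u i) q∤u-iq
    where
    q∤u-iq : q ∤ ℤ.∣ u ℤ.- + (i * q) ∣
    q∤u-iq q∣ = q∤u (ℤD.∣⇒∣ᵤ (subst (+ q ∣ℤ_) (ℤ-minus-plus u (+ (i * q)))
      (ℤD.∣m∣n⇒∣m+n (ℤD.∣ᵤ⇒∣ {+ q} {u ℤ.- + (i * q)} q∣) (ℤD.divides (+ i) (ℤP.pos-* i q)))))

  -- Dividing n by q:  n = q c + ρ with ρ < q, and  n! = q^c · c! · R  with q ∤ R
  -- (the multiples q, 2q, …, cq contribute q^c c!, the remaining factors are prime to q).
  factorial-split : ∀ n → Σ ℕ λ c → Σ ℕ λ ρ → Σ ℕ λ R →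
    ρ < q × n ≡ q * c + ρ × n ! ≡ q ^ c * c ! * R × q ∤ R
  factorial-split zero = 0 , 0 , 1 , ℕP.<-trans (s≤s z≤n) 1<q , sym (trans (ℕP.+-identityʳ (q * 0)) (ℕP.*-zeroʳ q)) , refl , q∤1
  factorial-split (suc n) with factorial-split n
  ... | c , ρ , R , ρ<q , n≡ , n!≡ , q∤R with suc ρ ℕ.<? q
  ...   | yes ρ+1<q = c , suc ρ , R * suc n , ρ+1<q , n+1≡ , trans (cong (suc n *_) n!≡) (regroup (suc n) (q ^ c) (c !) R) , q∤* q∤R q∤n+1
    where
    n+1≡ : suc n ≡ q * c + suc ρ
    n+1≡ = trans (cong suc n≡) (sym (ℕP.+-suc (q * c) ρ))
    q∤n+1 : q ∤ suc n
    q∤n+1 q∣ = ℕP.<⇒≱ ρ+1<q (ND.∣⇒≤ (ND.∣m+n∣m⇒∣n (subst (q ∣_) n+1≡ q∣) (ND.m∣m*n c)))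
    regroup : ∀ a b c d → a * (b * c * d) ≡ b * c * (d * a)
    regroup = ℕ-solve
  ...   | no ρ+1≮q = suc c , 0 , R , ℕP.<-trans (s≤s z≤n) 1<q , trans n+1≡ (sym (ℕP.+-identityʳ _)) ,
            trans (cong (suc n *_) n!≡) (trans (cong (λ z → z * (q ^ c * c ! * R)) n+1≡) (regroup q c (q ^ c) (c !) R)) ,
            q∤R
    where
    open ≡-Reasoning
    n+1≡ : suc n ≡ q * suc c
    n+1≡ = begin
      suc n            ≡⟨ trans (cong suc n≡) (sym (ℕP.+-suc (q * c) ρ)) ⟩
      q * c + suc ρ    ≡⟨ cong (λ z → q * c + z) (ℕP.≤-antisym ρ<q (ℕP.≮⇒≥ ρ+1≮q)) ⟩
      q * c + q        ≡⟨ trans (ℕP.+-comm (q * c) q) (sym (ℕP.*-suc q c)) ⟩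
      q * suc c        ∎
    regroup : ∀ q c Q F R → q * suc c * (Q * F * R) ≡ q * Q * (F + c * F) * R
    regroup = ℕ-solve

  legendre : ∀ n → Σ ℕ λ μ → Σ ℕ λ E → n ! ≡ μ * q ^ E × q ∤ μ × E * (q ∸ 1) ≤ n
  legendre = <-rec _ step
    where
    Legendre : ℕ → Set
    Legendre n = Σ ℕ λ μ → Σ ℕ λ E → n ! ≡ μ * q ^ E × q ∤ μ × E * (q ∸ 1) ≤ n
    step : ∀ n → (∀ {m} → m < n → Legendre m) → Legendre n
    step zero    _   = 1 , 0 , refl , q∤1 , z≤n
    step (suc n) rec with factorial-split (suc n)
    ... | c , ρ , R , ρ<q , n≡ , n!≡ , q∤R with rec c<n+1
      where
      c<n+1 : c < suc n
      c<n+1 = below c (subst (_≤ suc n) (ℕP.*-comm q c) (ℕP.≤-trans (ℕP.m≤m+n (q * c) ρ) (ℕP.≤-reflexive (sym n≡))))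
        where
        below : ∀ c → c * q ≤ suc n → c < suc n
        below zero        _    = s≤s z≤n
        below c@(suc _)   cq≤  = ℕP.<-≤-trans (ℕP.m<m*n c q 1<q) cq≤
    ... | μ , E , c!≡ , q∤μ , E-bound = μ * R , c + E , n!≡μqᴱ , q∤* q∤μ q∤R , bound
      where
      regroup : ∀ a b c d → a * (b * c) * d ≡ b * d * (a * c)
      regroup = ℕ-solve
      n!≡μqᴱ : suc n ! ≡ μ * R * q ^ (c + E)
      n!≡μqᴱ = begin-equality
        suc n !                    ≡⟨ n!≡ ⟩
        q ^ c * c ! * R            ≡⟨ cong (λ z → q ^ c * z * R) c!≡ ⟩
        q ^ c * (μ * q ^ E) * R    ≡⟨ regroup (q ^ c) μ (q ^ E) R ⟩
        μ * R * (q ^ c * q ^ E)    ≡⟨ cong (μ * R *_) (sym (ℕP.^-distribˡ-+-* q c E)) ⟩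
        μ * R * q ^ (c + E)        ∎
        where open ℕP.≤-Reasoning
      bound : (c + E) * (q ∸ 1) ≤ suc n
      bound = begin
        (c + E) * (q ∸ 1)              ≡⟨ ℕP.*-distribʳ-+ (q ∸ 1) c E ⟩
        c * (q ∸ 1) + E * (q ∸ 1)      ≤⟨ ℕP.+-monoʳ-≤ (c * (q ∸ 1)) (ℕP.≤-trans E-bound (ℕP.≤-reflexive (sym (ℕP.*-identityʳ c)))) ⟩
        c * (q ∸ 1) + c * 1            ≡⟨ sym (ℕP.*-distribˡ-+ c (q ∸ 1) 1) ⟩
        c * (q ∸ 1 + 1)                ≡⟨ cong (c *_) (ℕP.m∸n+n≡m (ℕP.<⇒≤ 1<q)) ⟩
        c * q                          ≡⟨ ℕP.*-comm c q ⟩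
        q * c                          ≤⟨ ℕP.m≤m+n (q * c) ρ ⟩
        q * c + ρ                      ≡⟨ sym n≡ ⟩
        suc n                          ∎
        where open ℕP.≤-Reasoning

signℤ : ℕ → ℤ
signℤ zero    = 1ℤ
signℤ (suc m) = ℤ.- signℤ m

sgn≡signℤ : ∀ m → sgn m ≡ ℤ→ℚ (signℤ m)
sgn≡signℤ zero    = refl
sgn≡signℤ (suc m) = trans (cong ℚ.-_ (sgn≡signℤ m)) (sym (ℤ→ℚ-neg (signℤ m)))

∣signℤ∣ : ∀ m → ℤ.∣ signℤ m ∣ ≡ 1
∣signℤ∣ zero    = refl
∣signℤ∣ (suc m) = trans (ℤP.∣-i∣≡∣i∣ (signℤ m)) (∣signℤ∣ m)

ijk!∣n! : ∀ i j k n → i + j + k ≤ n → i ! * j ! * k ! ∣ n !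
ijk!∣n! i j k n ijk≤n = ND.∣-trans (ND.*-monoˡ-∣ (k !) (k![n∸k]!∣ i j)) (ND.∣-trans (k![n∸k]!∣ (i + j) k) (ND.m≤n⇒m!∣n! ijk≤n))
  where
  k![n∸k]!∣ : ∀ a b → a ! * b ! ∣ (a + b) !
  k![n∸k]!∣ a b = subst (λ z → a ! * z ! ∣ (a + b) !) (ℕP.m+n∸m≡n a b) (ℕC.k![n∸k]!∣n! (ℕP.m≤m+n a b))

ijk!≢0 : ∀ i j k → NonZero (i ! * j ! * k !)
ijk!≢0 i j k = ℕP.m*n≢0 (i ! * j !) (k !) {{ℕP._!*_!≢0 i j}} {{ℕP._!≢0 k}}

multinomial : ℕ → ℕ → ℕ → ℕ → ℕ
multinomial n i j k = (n ! ℕ./ (i ! * j ! * k !)) {{ijk!≢0 i j k}}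

qⁿn!-split : ∀ q n i j k → i + j + k ≤ n →
  q ^ n * n ! ≡ (q ^ (n ∸ (i + j + k)) * multinomial n i j k) * (q ^ i * i !) * (q ^ j * j !) * (q ^ k * k !)
qⁿn!-split q n i j k ijk≤n = begin
    q ^ n * n !
      ≡⟨ cong₂ (λ x y → q ^ x * y) (sym (ℕP.m∸n+n≡m ijk≤n)) (sym (ℕD.m/n*n≡m {{ijk!≢0 i j k}} (ijk!∣n! i j k n ijk≤n))) ⟩
    q ^ (n ∸ (i + j + k) + (i + j + k)) * (multinomial n i j k * (i ! * j ! * k !))
      ≡⟨ cong (_* (multinomial n i j k * (i ! * j ! * k !))) (trans (ℕP.^-distribˡ-+-* q (n ∸ (i + j + k)) (i + j + k))
           (cong (q ^ (n ∸ (i + j + k)) *_) (trans (ℕP.^-distribˡ-+-* q (i + j) k) (cong (_* q ^ k) (ℕP.^-distribˡ-+-* q i j))))) ⟩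
    q ^ (n ∸ (i + j + k)) * (q ^ i * q ^ j * q ^ k) * (multinomial n i j k * (i ! * j ! * k !))
      ≡⟨ regroup (q ^ (n ∸ (i + j + k))) (q ^ i) (q ^ j) (q ^ k) (multinomial n i j k) (i !) (j !) (k !) ⟩
    (q ^ (n ∸ (i + j + k)) * multinomial n i j k) * (q ^ i * i !) * (q ^ j * j !) * (q ^ k * k !) ∎
  where
  open ≡-Reasoning
  regroup : ∀ a b c d e f g h → a * (b * c * d) * (e * (f * g * h)) ≡ (a * e) * (b * f) * (c * g) * (d * h)
  regroup = ℕ-solve

module Coefficient (q r s n : ℕ) .{{_ : NonZero q}} .{{_ : NonZero r}} .{{_ : NonZero s}}
  (α β γ : ℚ) (u₁ u₂ u₃ : ℤ)
  (αq≡u₁ : α ℚ.* ℕ→ℚ q ≡ ℤ→ℚ u₁) (βq≡u₂ : β ℚ.* ℕ→ℚ q ≡ ℤ→ℚ u₂) (γq≡u₃ : γ ℚ.* ℕ→ℚ q ≡ ℤ→ℚ u₃) where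

  k : ℕ → ℕ → ℕ
  k i j = n ∸ (r * i + s * j)

  deg : ℕ → ℕ → ℕ
  deg i j = i + j + k i j

  deg≤n : ∀ i j → r * i + s * j ≤ n → deg i j ≤ n
  deg≤n i j rs≤n = begin
    i + j + k i j               ≤⟨ ℕP.+-monoˡ-≤ (k i j) (ℕP.+-mono-≤ (ℕP.m≤n*m i r) (ℕP.m≤n*m j s)) ⟩
    r * i + s * j + k i j       ≡⟨ ℕP.m+[n∸m]≡n rs≤n ⟩
    n                           ∎
    where open ℕP.≤-Reasoning

  M : ℕ
  M = q ^ n * n !

  cofactor : ℕ → ℕ → ℕ
  cofactor i j = q ^ (n ∸ deg i j) * multinomial n i j (k i j)

  term : ℕ → ℕ → ℤ
  term i j = + cofactor i j ℤ.* qfall q u₁ i ℤ.* qfall q u₂ j ℤ.* qfall q u₃ (k i j) ℤ.* signℤ (deg i j)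

  M-split : ∀ i j → r * i + s * j ≤ n → M ≡ cofactor i j * (q ^ i * i !) * (q ^ j * j !) * (q ^ k i j * k i j !)
  M-split i j rs≤n = qⁿn!-split q n i j (k i j) (deg≤n i j rs≤n)

  term-scaled : ∀ i j → r * i + s * j ≤ n →
    ℕ→ℚ M ℚ.* (binom α i ℚ.* binom β j ℚ.* binom γ (k i j) ℚ.* sgn (deg i j)) ≡ ℤ→ℚ (term i j)
  term-scaled i j rs≤n = begin
      ℕ→ℚ M ℚ.* (bα ℚ.* bβ ℚ.* bγ ℚ.* σ)
        ≡⟨ cong (λ z → ℕ→ℚ z ℚ.* (bα ℚ.* bβ ℚ.* bγ ℚ.* σ)) (M-split i j rs≤n) ⟩
      ℕ→ℚ (C * Qᵢ * Qⱼ * Qₖ) ℚ.* (bα ℚ.* bβ ℚ.* bγ ℚ.* σ)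
        ≡⟨ cong (ℚ._* (bα ℚ.* bβ ℚ.* bγ ℚ.* σ)) (ℕ→ℚ-*₄ C Qᵢ Qⱼ Qₖ) ⟩
      (ℕ→ℚ C ℚ.* ℕ→ℚ Qᵢ ℚ.* ℕ→ℚ Qⱼ ℚ.* ℕ→ℚ Qₖ) ℚ.* (bα ℚ.* bβ ℚ.* bγ ℚ.* σ)
        ≡⟨ regroup (ℕ→ℚ C) (ℕ→ℚ Qᵢ) (ℕ→ℚ Qⱼ) (ℕ→ℚ Qₖ) bα bβ bγ σ ⟩
      ℕ→ℚ C ℚ.* (ℕ→ℚ Qᵢ ℚ.* bα) ℚ.* (ℕ→ℚ Qⱼ ℚ.* bβ) ℚ.* (ℕ→ℚ Qₖ ℚ.* bγ) ℚ.* σ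
        ≡⟨ cong₂ (λ x y → ℕ→ℚ C ℚ.* x ℚ.* y ℚ.* (ℕ→ℚ Qₖ ℚ.* bγ) ℚ.* σ)
             (binom-qfall q α u₁ αq≡u₁ i) (binom-qfall q β u₂ βq≡u₂ j) ⟩
      ℕ→ℚ C ℚ.* ℤ→ℚ (qfall q u₁ i) ℚ.* ℤ→ℚ (qfall q u₂ j) ℚ.* (ℕ→ℚ Qₖ ℚ.* bγ) ℚ.* σ
        ≡⟨ cong₂ (λ x y → ℕ→ℚ C ℚ.* ℤ→ℚ (qfall q u₁ i) ℚ.* ℤ→ℚ (qfall q u₂ j) ℚ.* x ℚ.* y)
             (binom-qfall q γ u₃ γq≡u₃ (k i j)) (sgn≡signℤ (deg i j)) ⟩
      ℕ→ℚ C ℚ.* ℤ→ℚ (qfall q u₁ i) ℚ.* ℤ→ℚ (qfall q u₂ j) ℚ.* ℤ→ℚ (qfall q u₃ (k i j)) ℚ.* ℤ→ℚ (signℤ (deg i j))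
        ≡⟨ ℤ→ℚ-*₅ (+ C) (qfall q u₁ i) (qfall q u₂ j) (qfall q u₃ (k i j)) (signℤ (deg i j)) ⟨
      ℤ→ℚ (term i j) ∎
    where
    open ≡-Reasoning
    bα = binom α i
    bβ = binom β j
    bγ = binom γ (k i j)
    σ = sgn (deg i j)
    C = cofactor i j
    Qᵢ = q ^ i * i !
    Qⱼ = q ^ j * j !
    Qₖ = q ^ k i j * k i j !
    regroup : ∀ A B C D a b c s → (A ℚ.* B ℚ.* C ℚ.* D) ℚ.* (a ℚ.* b ℚ.* c ℚ.* s)
                                ≡ A ℚ.* (B ℚ.* a) ℚ.* (C ℚ.* b) ℚ.* (D ℚ.* c) ℚ.* s
    regroup = solve-∀ ℚ-ring
    ℤ→ℚ-*₅ : ∀ x y z w v → ℤ→ℚ (x ℤ.* y ℤ.* z ℤ.* w ℤ.* v) ≡ ℤ→ℚ x ℚ.* ℤ→ℚ y ℚ.* ℤ→ℚ z ℚ.* ℤ→ℚ w ℚ.* ℤ→ℚ v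
    ℤ→ℚ-*₅ x y z w v = trans (ℤ→ℚ-* (x ℤ.* y ℤ.* z ℤ.* w) v) (cong (ℚ._* ℤ→ℚ v)
      (trans (ℤ→ℚ-* (x ℤ.* y ℤ.* z) w) (cong (ℚ._* ℤ→ℚ w) (trans (ℤ→ℚ-* (x ℤ.* y) z) (cong (ℚ._* ℤ→ℚ z) (ℤ→ℚ-* x y))))))

  summand : ℕ → ℕ → ℚ
  summand i j = if (r * i + s * j) ℕ.≤ᵇ n
                then binom α i ℚ.* binom β j ℚ.* binom γ (k i j) ℚ.* sgn (deg i j)
                else 0ℚ

  termℤ : ℕ → ℕ → ℤ
  termℤ i j = if (r * i + s * j) ℕ.≤ᵇ n then term i j else 0ℤ

  T : ℤ
  T = sumℤ (map (λ i → sumℤ (map (termℤ i) (upTo (suc n)))) (upTo (suc n)))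

  M·aₙ≡T : ℕ→ℚ M ℚ.* coeff α β γ r s n ≡ ℤ→ℚ T
  M·aₙ≡T = sum-scale-ℤ→ℚ (ℕ→ℚ M) (λ i → sumℚ (map (summand i) (upTo (suc n)))) (λ i → sumℤ (map (termℤ i) (upTo (suc n))))
             (λ i → sum-scale-ℤ→ℚ (ℕ→ℚ M) (summand i) (termℤ i) (summand-scaled i) (upTo (suc n))) (upTo (suc n))
    where
    summand-scaled : ∀ i j → ℕ→ℚ M ℚ.* summand i j ≡ ℤ→ℚ (termℤ i j)
    summand-scaled i j with (r * i + s * j) ℕ.≤ᵇ n in eq
    ... | true  = term-scaled i j (ℕP.≤ᵇ⇒≤ (r * i + s * j) n (subst True (sym eq) _))
    ... | false = ℚP.*-zeroʳ (ℕ→ℚ M)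

  -- If every |uᵢ| ≤ q, each term is at most M in absolute value, so |T| ≤ M (⌊n/r⌋+1)(⌊n/s⌋+1).
  module _ (∣u₁∣≤q : ℤ.∣ u₁ ∣ ≤ q) (∣u₂∣≤q : ℤ.∣ u₂ ∣ ≤ q) (∣u₃∣≤q : ℤ.∣ u₃ ∣ ≤ q) where

    ∣term∣≤M : ∀ i j → r * i + s * j ≤ n → ℤ.∣ term i j ∣ ≤ M
    ∣term∣≤M i j rs≤n = begin
        ℤ.∣ term i j ∣
          ≡⟨ ∣*₅∣ (+ C) (qfall q u₁ i) (qfall q u₂ j) (qfall q u₃ (k i j)) (signℤ (deg i j)) ⟩
        C * ℤ.∣ qfall q u₁ i ∣ * ℤ.∣ qfall q u₂ j ∣ * ℤ.∣ qfall q u₃ (k i j) ∣ * ℤ.∣ signℤ (deg i j) ∣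
          ≤⟨ ℕP.*-mono-≤ (ℕP.*-mono-≤ (ℕP.*-mono-≤ (ℕP.*-monoʳ-≤ C (qfall-bound q u₁ ∣u₁∣≤q i))
               (qfall-bound q u₂ ∣u₂∣≤q j)) (qfall-bound q u₃ ∣u₃∣≤q (k i j))) (ℕP.≤-reflexive (∣signℤ∣ (deg i j))) ⟩
        C * (q ^ i * i !) * (q ^ j * j !) * (q ^ k i j * k i j !) * 1
          ≡⟨ ℕP.*-identityʳ _ ⟩
        C * (q ^ i * i !) * (q ^ j * j !) * (q ^ k i j * k i j !)
          ≡⟨ M-split i j rs≤n ⟨
        M ∎
      where
      open ℕP.≤-Reasoning
      C = cofactor i j
      ∣*₅∣ : ∀ a b c d e → ℤ.∣ a ℤ.* b ℤ.* c ℤ.* d ℤ.* e ∣ ≡ ℤ.∣ a ∣ * ℤ.∣ b ∣ * ℤ.∣ c ∣ * ℤ.∣ d ∣ * ℤ.∣ e ∣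
      ∣*₅∣ a b c d e = trans (ℤP.abs-* (a ℤ.* b ℤ.* c ℤ.* d) e) (cong (_* ℤ.∣ e ∣)
        (trans (ℤP.abs-* (a ℤ.* b ℤ.* c) d) (cong (_* ℤ.∣ d ∣) (trans (ℤP.abs-* (a ℤ.* b) c) (cong (_* ℤ.∣ c ∣) (ℤP.abs-* a b))))))

    -- a nonzero summand needs both r i ≤ n and s j ≤ n
    ∣termℤ∣≤ : ∀ i j → ℤ.∣ termℤ i j ∣ ≤ M * 𝟙 (r * i ℕ.≤ᵇ n) * 𝟙 (s * j ℕ.≤ᵇ n)
    ∣termℤ∣≤ i j with (r * i + s * j) ℕ.≤ᵇ n in eq
    ... | false = z≤n
    ... | true  = subst (ℤ.∣ term i j ∣ ≤_) (sym M𝟙𝟙≡M) (∣term∣≤M i j rs≤n)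
      where
      rs≤n : r * i + s * j ≤ n
      rs≤n = ℕP.≤ᵇ⇒≤ (r * i + s * j) n (subst True (sym eq) _)
      M𝟙𝟙≡M : M * 𝟙 (r * i ℕ.≤ᵇ n) * 𝟙 (s * j ℕ.≤ᵇ n) ≡ M
      M𝟙𝟙≡M rewrite 𝟙-≤ᵇ (ℕP.≤-trans (ℕP.m≤m+n (r * i) (s * j)) rs≤n)
                   | 𝟙-≤ᵇ (ℕP.≤-trans (ℕP.m≤n+m (s * j) (r * i)) rs≤n)
        = trans (ℕP.*-identityʳ _) (ℕP.*-identityʳ M)

    ∣T∣≤ : ℤ.∣ T ∣ ≤ M * (n ℕ./ r + 1) * (n ℕ./ s + 1)
    ∣T∣≤ = begin
        ℤ.∣ T ∣
          ≤⟨ ∣sumℤ∣≤sumℕ∣∣ (λ i → sumℤ (map (termℤ i) L)) L ⟩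
        sumℕ (map (λ i → ℤ.∣ sumℤ (map (termℤ i) L) ∣) L)
          ≤⟨ sumℕ-mono-≤ (λ i → ℕP.≤-trans (∣sumℤ∣≤sumℕ∣∣ (termℤ i) L) (sumℕ-mono-≤ (∣termℤ∣≤ i) L)) L ⟩
        sumℕ (map (λ i → sumℕ (map (λ j → M * 𝟙ᵣ i * 𝟙ₛ j) L)) L)
          ≡⟨ sumℕ-separable (λ i → M * 𝟙ᵣ i) 𝟙ₛ L L ⟩
        sumℕ (map (λ i → M * 𝟙ᵣ i) L) * sumℕ (map 𝟙ₛ L)
          ≡⟨ cong (_* sumℕ (map 𝟙ₛ L)) (sumℕ-*ˡ M 𝟙ᵣ L) ⟩
        M * sumℕ (map 𝟙ᵣ L) * sumℕ (map 𝟙ₛ L)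
          ≤⟨ ℕP.*-mono-≤ (ℕP.*-monoʳ-≤ M (count-multiples r n (suc n) 0 (λ t → t) (λ t → refl)))
                          (count-multiples s n (suc n) 0 (λ t → t) (λ t → refl)) ⟩
        M * (n ℕ./ r + 1) * (n ℕ./ s + 1) ∎
      where
      open ℕP.≤-Reasoning
      L = upTo (suc n)
      𝟙ᵣ 𝟙ₛ : ℕ → ℕ
      𝟙ᵣ i = 𝟙 (r * i ℕ.≤ᵇ n)
      𝟙ₛ j = 𝟙 (s * j ℕ.≤ᵇ n)

  -- For a prime q with q ∤ u₃ and r, s ≥ 2, the integer T is prime to q: every term with
  -- (i, j) ≠ (0, 0) has degree < n, hence a factor q in its cofactor, while the term (0, 0)
  -- is ± u₃ (u₃ - q) ⋯ (u₃ - (n-1) q) ≡ ± u₃ⁿ (mod q).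
  module _ (q-prime : Prime q) (2≤r : 2 ≤ r) (2≤s : 2 ≤ s) (q∤u₃ : q ∤ ℤ.∣ u₃ ∣) where
    open PrimeFacts q q-prime

    deg<n : ∀ i j → 0 < i + j → r * i + s * j ≤ n → deg i j < n
    deg<n i j 0<i+j rs≤n = begin-strict
        i + j + k i j               <⟨ ℕP.+-monoˡ-< (k i j) i+j<ri+sj ⟩
        r * i + s * j + k i j       ≡⟨ ℕP.m+[n∸m]≡n rs≤n ⟩
        n                           ∎
      where
      open ℕP.≤-Reasoning
      double : ∀ i j → (i + j) + (i + j) ≡ 2 * i + 2 * j
      double = ℕ-solve
      i+j<ri+sj : i + j < r * i + s * j
      i+j<ri+sj = begin-strict
        i + j                       <⟨ ℕP.m<m+n (i + j) 0<i+j ⟩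
        (i + j) + (i + j)           ≡⟨ double i j ⟩
        2 * i + 2 * j               ≤⟨ ℕP.+-mono-≤ (ℕP.*-monoˡ-≤ i 2≤r) (ℕP.*-monoˡ-≤ j 2≤s) ⟩
        r * i + s * j               ∎

    q∣termℤ : ∀ i j → 0 < i + j → + q ∣ℤ termℤ i j
    q∣termℤ i j 0<i+j with (r * i + s * j) ℕ.≤ᵇ n in eq
    ... | false = ℤD.divides 0ℤ (sym (ℤP.*-zeroˡ (+ q)))
    ... | true  = ℤD.∣m⇒∣m*n _ (ℤD.∣m⇒∣m*n _ (ℤD.∣m⇒∣m*n _ (ℤD.∣m⇒∣m*n _ (ℤD.∣ᵤ⇒∣ {+ q} {+ cofactor i j} q∣cofactor))))
      where
      rs≤n : r * i + s * j ≤ n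
      rs≤n = ℕP.≤ᵇ⇒≤ (r * i + s * j) n (subst True (sym eq) _)
      q∣cofactor : q ∣ cofactor i j
      q∣cofactor with n ∸ deg i j | ℕP.m<n⇒0<n∸m (deg<n i j 0<i+j rs≤n)
      ... | suc e | _ = ND.∣m⇒∣m*n (multinomial n i j (k i j)) (ND.m∣m*n (q ^ e))

    rs00≤n : r * 0 + s * 0 ≤ n
    rs00≤n rewrite ℕP.*-zeroʳ r | ℕP.*-zeroʳ s = z≤n

    k00≡n : k 0 0 ≡ n
    k00≡n rewrite ℕP.*-zeroʳ r | ℕP.*-zeroʳ s = refl

    -- the split of M at (0, 0) reads M = cofactor 0 0 · M
    cofactor00≡1 : cofactor 0 0 ≡ 1
    cofactor00≡1 = ℕP.*-cancelʳ-≡ (cofactor 0 0) 1 M {{M≢0}} (sym (begin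
        1 * M                                      ≡⟨ ℕP.*-identityˡ M ⟩
        M                                          ≡⟨ M-split 0 0 rs00≤n ⟩
        cofactor 0 0 * 1 * 1 * (q ^ k 0 0 * k 0 0 !)
          ≡⟨ cong (_* (q ^ k 0 0 * k 0 0 !)) (trans (ℕP.*-identityʳ (cofactor 0 0 * 1)) (ℕP.*-identityʳ (cofactor 0 0))) ⟩
        cofactor 0 0 * (q ^ k 0 0 * k 0 0 !)       ≡⟨ cong (λ y → cofactor 0 0 * (q ^ y * y !)) k00≡n ⟩
        cofactor 0 0 * M                           ∎))
      where
      open ≡-Reasoning
      M≢0 : NonZero M
      M≢0 = ℕP.m*n≢0 (q ^ n) (n !) {{ℕP.m^n≢0 q n}} {{ℕP._!≢0 n}}

    q∤termℤ00 : q ∤ ℤ.∣ termℤ 0 0 ∣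
    q∤termℤ00 with (r * 0 + s * 0) ℕ.≤ᵇ n in eq
    ... | false = ⊥-elim (subst True eq (ℕP.≤⇒≤ᵇ rs00≤n))
    ... | true  = q∤∣*∣ {+ cofactor 0 0 ℤ.* 1ℤ ℤ.* 1ℤ ℤ.* qfall q u₃ (k 0 0)}
                    (q∤∣*∣ {+ cofactor 0 0 ℤ.* 1ℤ ℤ.* 1ℤ}
                      (q∤∣*∣ {+ cofactor 0 0 ℤ.* 1ℤ} (q∤∣*∣ {+ cofactor 0 0} (subst (q ∤_) (sym cofactor00≡1) q∤1) q∤1) q∤1)
                      (qfall-∤ u₃ q∤u₃ (k 0 0)))
                    (subst (q ∤_) (sym (∣signℤ∣ (deg 0 0))) q∤1)

    q∤T : q ∤ ℤ.∣ T ∣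
    q∤T q∣T = q∤termℤ00 (ℤD.∣⇒∣ᵤ {+ q} {termℤ 0 0} (ℤD.∣m+n∣n⇒∣m (ℤD.∣m+n∣n⇒∣m (ℤD.∣ᵤ⇒∣ {+ q} {T} q∣T) q∣rows) q∣row₀))
      where
      q∣row₀ : + q ∣ℤ sumℤ (map (termℤ 0) (applyUpTo suc n))
      q∣row₀ = ∣-sumℤ (+ q) (termℤ 0) suc n (λ t → q∣termℤ 0 (suc t) (s≤s z≤n))
      q∣rows : + q ∣ℤ sumℤ (map (λ i → sumℤ (map (termℤ i) (upTo (suc n)))) (applyUpTo suc n))
      q∣rows = ∣-sumℤ (+ q) (λ i → sumℤ (map (termℤ i) (upTo (suc n)))) suc n
                 (λ t → ∣-sumℤ (+ q) (termℤ (suc t)) (λ x → x) (suc n) (λ j → q∣termℤ (suc t) j (s≤s z≤n)))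

  -- If μ is coprime to q and divides n!, then μ ∣ T: with q Nᵢ ≡ uᵢ (mod μ) each qfall q uᵢ i is
  -- ≡ qⁱ i! yᵢ, so each term is ≡ M · y₁ y₂ y₃ (-1)^deg ≡ 0 (mod μ).
  μ∣T : ∀ μ .{{_ : NonZero μ}} → Coprime q μ → μ ∣ n ! → + μ ∣ℤ T
  μ∣T μ q⊥μ μ∣n! = ∣-sumℤ (+ μ) (λ i → sumℤ (map (termℤ i) (upTo (suc n)))) (λ x → x) (suc n)
                     (λ i → ∣-sumℤ (+ μ) (termℤ i) (λ x → x) (suc n) (μ∣termℤ i))
    where
    N : ℤ → ℕ
    N u = proj₁ (divide-mod q μ q⊥μ u)

    scaled : ∀ u i → Σ ℤ λ y → + μ ∣ℤ (qfall q u i ℤ.- + (q ^ i * i !) ℤ.* y)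
    scaled u = qfall-≡-i!-multiple q (+ μ) u (N u) (proj₂ (divide-mod q μ q⊥μ u))

    μ∣M : + μ ∣ℤ + M
    μ∣M = ℤD.∣ᵤ⇒∣ {+ μ} {+ M} (ND.∣n⇒∣m*n (q ^ n) μ∣n!)

    μ∣term : ∀ i j → r * i + s * j ≤ n → + μ ∣ℤ term i j
    μ∣term i j rs≤n with scaled u₁ i | scaled u₂ j | scaled u₃ (k i j)
    ... | y₁ , ≡₁ | y₂ , ≡₂ | y₃ , ≡₃ =
      subst (+ μ ∣ℤ_) (ℤ-minus-plus (term i j) Z) (ℤD.∣m∣n⇒∣m+n term≡Z μ∣Z)
      where
      C = + cofactor i j
      σ = signℤ (deg i j)
      Qᵢ = q ^ i * i !
      Qⱼ = q ^ j * j !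
      Qₖ = q ^ k i j * k i j !
      Z : ℤ
      Z = C ℤ.* (+ Qᵢ ℤ.* y₁) ℤ.* (+ Qⱼ ℤ.* y₂) ℤ.* (+ Qₖ ℤ.* y₃) ℤ.* σ
      term≡Z : + μ ∣ℤ (term i j ℤ.- Z)
      P₁ = qfall q u₁ i
      P₂ = qfall q u₂ j
      P₃ = qfall q u₃ (k i j)
      F₁ = + Qᵢ ℤ.* y₁
      F₂ = + Qⱼ ℤ.* y₂
      F₃ = + Qₖ ℤ.* y₃
      term≡Z = ∣-*-congruence (+ μ) (C ℤ.* P₁ ℤ.* P₂ ℤ.* P₃) (C ℤ.* F₁ ℤ.* F₂ ℤ.* F₃) σ σ
                 (∣-*-congruence (+ μ) (C ℤ.* P₁ ℤ.* P₂) (C ℤ.* F₁ ℤ.* F₂) P₃ F₃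
                   (∣-*-congruence (+ μ) (C ℤ.* P₁) (C ℤ.* F₁) P₂ F₂
                     (∣-*-congruence (+ μ) C C P₁ F₁ (∣-congruence-refl (+ μ) C) ≡₁) ≡₂) ≡₃)
                 (∣-congruence-refl (+ μ) σ)
      regroup : ∀ C a b c y₁ y₂ y₃ σ → C ℤ.* (a ℤ.* y₁) ℤ.* (b ℤ.* y₂) ℤ.* (c ℤ.* y₃) ℤ.* σ
                                    ≡ (C ℤ.* a ℤ.* b ℤ.* c) ℤ.* (y₁ ℤ.* y₂ ℤ.* y₃ ℤ.* σ)
      regroup = ℤ-solve
      Z≡M·y : Z ≡ + M ℤ.* (y₁ ℤ.* y₂ ℤ.* y₃ ℤ.* σ)
      Z≡M·y = trans (regroup C (+ Qᵢ) (+ Qⱼ) (+ Qₖ) y₁ y₂ y₃ σ)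
        (cong (ℤ._* (y₁ ℤ.* y₂ ℤ.* y₃ ℤ.* σ))
          (trans (sym (pos-*₄ (cofactor i j) Qᵢ Qⱼ Qₖ)) (cong +_ (sym (M-split i j rs≤n)))))
      μ∣Z : + μ ∣ℤ Z
      μ∣Z = subst (+ μ ∣ℤ_) (sym Z≡M·y) (ℤD.∣m⇒∣m*n _ μ∣M)

    μ∣termℤ : ∀ i j → + μ ∣ℤ termℤ i j
    μ∣termℤ i j with (r * i + s * j) ℕ.≤ᵇ n in eq
    ... | false = ℤD.divides 0ℤ (sym (ℤP.*-zeroˡ (+ μ)))
    ... | true  = μ∣term i j (ℕP.≤ᵇ⇒≤ (r * i + s * j) n (subst True (sym eq) _))

module Powers (q : ℕ) .{{_ : NonZero q}} where

  qpow-neg : ∀ m → qpow q (ℤ.- (+ m)) ℚ.* ℕ→ℚ (q ^ m) ≡ 1ℚ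
  qpow-neg zero    = refl
  qpow-neg (suc m) = /-*-denominator (+ 1) (q ^ suc m) {{ℕP.m^n≢0 q (suc m)}}

  qpow-⊖ : ∀ a b → qpow q (a ℤ.⊖ b) ℚ.* ℕ→ℚ (q ^ b) ≡ ℕ→ℚ (q ^ a)
  qpow-⊖ a b with ℕP.≤-<-connex b a
  ... | inj₁ b≤a = begin
      qpow q (a ℤ.⊖ b) ℚ.* ℕ→ℚ (q ^ b)        ≡⟨ cong (λ v → qpow q v ℚ.* ℕ→ℚ (q ^ b)) (ℤP.⊖-≥ b≤a) ⟩
      ℕ→ℚ (q ^ (a ∸ b)) ℚ.* ℕ→ℚ (q ^ b)       ≡⟨ ℕ→ℚ-* (q ^ (a ∸ b)) (q ^ b) ⟨
      ℕ→ℚ (q ^ (a ∸ b) * q ^ b)               ≡⟨ cong ℕ→ℚ (trans (sym (ℕP.^-distribˡ-+-* q (a ∸ b) b)) (cong (q ^_) (ℕP.m∸n+n≡m b≤a))) ⟩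
      ℕ→ℚ (q ^ a)                             ∎
    where open ≡-Reasoning
  ... | inj₂ a<b = begin
      qpow q (a ℤ.⊖ b) ℚ.* ℕ→ℚ (q ^ b)                      ≡⟨ cong (λ v → qpow q v ℚ.* ℕ→ℚ (q ^ b)) (ℤP.⊖-< a<b) ⟩
      qpow q (ℤ.- (+ (b ∸ a))) ℚ.* ℕ→ℚ (q ^ b)              ≡⟨ cong (λ m → qpow q (ℤ.- (+ (b ∸ a))) ℚ.* ℕ→ℚ m) q^b≡ ⟩
      qpow q (ℤ.- (+ (b ∸ a))) ℚ.* ℕ→ℚ (q ^ (b ∸ a) * q ^ a) ≡⟨ cong (qpow q (ℤ.- (+ (b ∸ a))) ℚ.*_) (ℕ→ℚ-* (q ^ (b ∸ a)) (q ^ a)) ⟩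
      qpow q (ℤ.- (+ (b ∸ a))) ℚ.* (ℕ→ℚ (q ^ (b ∸ a)) ℚ.* ℕ→ℚ (q ^ a))
                                                             ≡⟨ ℚP.*-assoc (qpow q (ℤ.- (+ (b ∸ a)))) (ℕ→ℚ (q ^ (b ∸ a))) (ℕ→ℚ (q ^ a)) ⟨
      qpow q (ℤ.- (+ (b ∸ a))) ℚ.* ℕ→ℚ (q ^ (b ∸ a)) ℚ.* ℕ→ℚ (q ^ a)
                                                             ≡⟨ cong (ℚ._* ℕ→ℚ (q ^ a)) (qpow-neg (b ∸ a)) ⟩
      1ℚ ℚ.* ℕ→ℚ (q ^ a)                                     ≡⟨ ℚP.*-identityˡ _ ⟩
      ℕ→ℚ (q ^ a)                                            ∎
    where
    open ≡-Reasoning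
    q^b≡ : q ^ b ≡ q ^ (b ∸ a) * q ^ a
    q^b≡ = trans (cong (q ^_) (sym (ℕP.m∸n+n≡m (ℕP.<⇒≤ a<b)))) (ℕP.^-distribˡ-+-* q (b ∸ a) a)

  qpow-cancel : ∀ k e → ℕ→ℚ (q ^ k) ℚ.* qpow q e ℚ.* qpow q (ℤ.- (+ k) ℤ.- e) ≡ 1ℚ
  qpow-cancel k (+ m) = begin
      ℕ→ℚ (q ^ k) ℚ.* ℕ→ℚ (q ^ m) ℚ.* qpow q (ℤ.- (+ k) ℤ.- + m)
        ≡⟨ cong₂ (λ x v → x ℚ.* qpow q v) (sym (trans (cong ℕ→ℚ (ℕP.^-distribˡ-+-* q k m)) (ℕ→ℚ-* (q ^ k) (q ^ m)))) -k-m≡ ⟩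
      ℕ→ℚ (q ^ (k + m)) ℚ.* qpow q (ℤ.- (+ (k + m)))  ≡⟨ ℚP.*-comm (ℕ→ℚ (q ^ (k + m))) (qpow q (ℤ.- (+ (k + m)))) ⟩
      qpow q (ℤ.- (+ (k + m))) ℚ.* ℕ→ℚ (q ^ (k + m))  ≡⟨ qpow-neg (k + m) ⟩
      1ℚ                                              ∎
    where
    open ≡-Reasoning
    neg-+ : ∀ a b → ℤ.- a ℤ.- b ≡ ℤ.- (a ℤ.+ b)
    neg-+ = ℤ-solve
    -k-m≡ : ℤ.- (+ k) ℤ.- + m ≡ ℤ.- (+ (k + m))
    -k-m≡ = trans (neg-+ (+ k) (+ m)) (cong ℤ.-_ (sym (ℤP.pos-+ k m)))
  qpow-cancel k -[1+ m ] = begin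
      ℕ→ℚ (q ^ k) ℚ.* qpow q (ℤ.- (+ suc m)) ℚ.* qpow q (ℤ.- (+ k) ℤ.- -[1+ m ])
        ≡⟨ cong (λ v → ℕ→ℚ (q ^ k) ℚ.* qpow q (ℤ.- (+ suc m)) ℚ.* qpow q v) -k+m+1≡ ⟩
      ℕ→ℚ (q ^ k) ℚ.* qpow q (ℤ.- (+ suc m)) ℚ.* qpow q (suc m ℤ.⊖ k)
        ≡⟨ regroup (ℕ→ℚ (q ^ k)) (qpow q (ℤ.- (+ suc m))) (qpow q (suc m ℤ.⊖ k)) ⟩
      qpow q (ℤ.- (+ suc m)) ℚ.* (qpow q (suc m ℤ.⊖ k) ℚ.* ℕ→ℚ (q ^ k))
        ≡⟨ cong (qpow q (ℤ.- (+ suc m)) ℚ.*_) (qpow-⊖ (suc m) k) ⟩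
      qpow q (ℤ.- (+ suc m)) ℚ.* ℕ→ℚ (q ^ suc m)
        ≡⟨ qpow-neg (suc m) ⟩
      1ℚ ∎
    where
    open ≡-Reasoning
    regroup : ∀ a b c → a ℚ.* b ℚ.* c ≡ b ℚ.* (c ℚ.* a)
    regroup = solve-∀ ℚ-ring
    neg-neg : ∀ a b → ℤ.- a ℤ.- ℤ.- b ≡ b ℤ.- a
    neg-neg = ℤ-solve
    -k+m+1≡ : ℤ.- (+ k) ℤ.- -[1+ m ] ≡ suc m ℤ.⊖ k
    -k+m+1≡ = trans (neg-neg (+ k) (+ suc m)) (ℤP.[+m]-[+n]≡m⊖n (suc m) k)

fraction-product : ∀ u u′ T w w′ → u ℤ.* u′ ≡ + (suc w * suc w′) ℤ.* T → (u / suc w) ℚ.* (u′ / suc w′) ≡ ℤ→ℚ T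
fraction-product u u′ T w w′ uu′≡ = ℕ→ℚ-*-cancelˡ (suc w * suc w′) ((u / suc w) ℚ.* (u′ / suc w′)) (ℤ→ℚ T) (begin
    ℕ→ℚ (suc w * suc w′) ℚ.* (f ℚ.* g)              ≡⟨ cong (ℚ._* (f ℚ.* g)) (ℕ→ℚ-* (suc w) (suc w′)) ⟩
    (ℕ→ℚ (suc w) ℚ.* ℕ→ℚ (suc w′)) ℚ.* (f ℚ.* g)   ≡⟨ regroup (ℕ→ℚ (suc w)) (ℕ→ℚ (suc w′)) f g ⟩
    (f ℚ.* ℕ→ℚ (suc w)) ℚ.* (g ℚ.* ℕ→ℚ (suc w′))   ≡⟨ cong₂ ℚ._*_ (/-*-denominator u (suc w)) (/-*-denominator u′ (suc w′)) ⟩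
    ℤ→ℚ u ℚ.* ℤ→ℚ u′                               ≡⟨ ℤ→ℚ-* u u′ ⟨
    ℤ→ℚ (u ℤ.* u′)                                 ≡⟨ cong ℤ→ℚ uu′≡ ⟩
    ℤ→ℚ (+ (suc w * suc w′) ℤ.* T)                 ≡⟨ ℤ→ℚ-* (+ (suc w * suc w′)) T ⟩
    ℕ→ℚ (suc w * suc w′) ℚ.* ℤ→ℚ T                 ∎)
  where
  open ≡-Reasoning
  f = u / suc w
  g = u′ / suc w′
  regroup : ∀ W W′ f g → (W ℚ.* W′) ℚ.* (f ℚ.* g) ≡ (f ℚ.* W) ℚ.* (g ℚ.* W′)
  regroup = solve-∀ ℚ-ring

unit-equation : ∀ q .{{_ : NonZero q}} k F .{{_ : NonZero F}} x T e u w u′ w′ →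
  ℕ→ℚ (q ^ k * F) ℚ.* x ≡ ℤ→ℚ T → ℕ→ℚ F ≡ (u / suc w) ℚ.* qpow q e →
  u ℤ.* u′ ≡ + (suc w * suc w′) ℤ.* T → x ≡ (u′ / suc w′) ℚ.* qpow q (ℤ.- (+ k) ℤ.- e)
unit-equation q k F x T e u w u′ w′ qᵏF·x≡T F≡ uu′≡ =
  ℕ→ℚ-*-cancelˡ (q ^ k * F) {{ℕP.m*n≢0 (q ^ k) F {{ℕP.m^n≢0 q k}}}} x (g ℚ.* qv) (begin
    ℕ→ℚ (q ^ k * F) ℚ.* x                      ≡⟨ qᵏF·x≡T ⟩
    ℤ→ℚ T                                      ≡⟨ ℚP.*-identityʳ (ℤ→ℚ T) ⟨
    ℤ→ℚ T ℚ.* 1ℚ                               ≡⟨ cong₂ ℚ._*_ (fraction-product u u′ T w w′ uu′≡) (qpow-cancel k e) ⟨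
    (f ℚ.* g) ℚ.* (ℕ→ℚ (q ^ k) ℚ.* qe ℚ.* qv)  ≡⟨ regroup f g (ℕ→ℚ (q ^ k)) qe qv ⟩
    ℕ→ℚ (q ^ k) ℚ.* (f ℚ.* qe) ℚ.* (g ℚ.* qv)  ≡⟨ cong (λ z → ℕ→ℚ (q ^ k) ℚ.* z ℚ.* (g ℚ.* qv)) F≡ ⟨
    ℕ→ℚ (q ^ k) ℚ.* ℕ→ℚ F ℚ.* (g ℚ.* qv)       ≡⟨ cong (ℚ._* (g ℚ.* qv)) (ℕ→ℚ-* (q ^ k) F) ⟨
    ℕ→ℚ (q ^ k * F) ℚ.* (g ℚ.* qv)             ∎)
  where
  open ≡-Reasoning
  open Powers q
  f = u / suc w
  g = u′ / suc w′
  qe = qpow q e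
  qv = qpow q (ℤ.- (+ k) ℤ.- e)
  regroup : ∀ f g Q qe qv → (f ℚ.* g) ℚ.* (Q ℚ.* qe ℚ.* qv) ≡ Q ℚ.* (f ℚ.* qe) ℚ.* (g ℚ.* qv)
  regroup = solve-∀ ℚ-ring

ord-transfer : ∀ q .{{_ : NonZero q}} → Prime q → ∀ k F .{{_ : NonZero F}} x T e →
  ℕ→ℚ (q ^ k * F) ℚ.* x ≡ ℤ→ℚ T → q ∤ ℤ.∣ T ∣ → IsOrd q (ℕ→ℚ F) e → IsOrd q x (ℤ.- (+ k) ℤ.- e)
ord-transfer q q-prime k F x T e _ _ (+ zero , _ , q∤0 , _) = ⊥-elim (q∤0 (q ND.∣0))
ord-transfer q q-prime k F x T e qᵏF·x≡T q∤T (+[1+ w′ ] , w , q∤u , q∤w , F≡) =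
  T ℤ.* + suc w , w′ , PrimeFacts.q∤∣*∣ q q-prime {T} q∤T q∤w , q∤u ,
  unit-equation q k F x T e +[1+ w′ ] w (T ℤ.* + suc w) w′ qᵏF·x≡T F≡
    (trans (regroup (+ suc w′) (+ suc w) T) (cong (ℤ._* T) (sym (ℤP.pos-* (suc w) (suc w′)))))
  where
  regroup : ∀ a b T → a ℤ.* (T ℤ.* b) ≡ b ℤ.* a ℤ.* T
  regroup = ℤ-solve
ord-transfer q q-prime k F x T e qᵏF·x≡T q∤T (-[1+ w′ ] , w , q∤u , q∤w , F≡) =
  ℤ.- (T ℤ.* + suc w) , w′ , q∤∣-Tw∣ , q∤u ,
  unit-equation q k F x T e -[1+ w′ ] w (ℤ.- (T ℤ.* + suc w)) w′ qᵏF·x≡T F≡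
    (trans (regroup (+ suc w′) (+ suc w) T) (cong (ℤ._* T) (sym (ℤP.pos-* (suc w) (suc w′)))))
  where
  regroup : ∀ a b T → ℤ.- a ℤ.* ℤ.- (T ℤ.* b) ≡ b ℤ.* a ℤ.* T
  regroup = ℤ-solve
  q∤∣-Tw∣ : q ∤ ℤ.∣ ℤ.- (T ℤ.* + suc w) ∣
  q∤∣-Tw∣ = subst (q ∤_) (sym (ℤP.∣-i∣≡∣i∣ (T ℤ.* + suc w))) (PrimeFacts.q∤∣*∣ q q-prime {T} q∤T q∤w)

integral-transfer : ∀ q k F .{{_ : NonZero F}} μ E D x T →
  ℕ→ℚ (q ^ k * F) ℚ.* x ≡ ℤ→ℚ T → F ≡ μ * q ^ E → + μ ∣ℤ T → E ≤ D →
  Σ ℤ λ z → ℕ→ℚ (q ^ (k + D)) ℚ.* x ≡ ℤ→ℚ z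
integral-transfer q k F μ E D x T qᵏF·x≡T F≡μqᴱ (ℤD.divides Z T≡Zμ) E≤D =
  z , ℕ→ℚ-*-cancelˡ F (ℕ→ℚ (q ^ (k + D)) ℚ.* x) (ℤ→ℚ z) (begin
    ℕ→ℚ F ℚ.* (ℕ→ℚ (q ^ (k + D)) ℚ.* x)
      ≡⟨ cong (λ y → ℕ→ℚ F ℚ.* (y ℚ.* x)) (trans (cong ℕ→ℚ (ℕP.^-distribˡ-+-* q k D)) (ℕ→ℚ-* (q ^ k) (q ^ D))) ⟩
    ℕ→ℚ F ℚ.* ((ℕ→ℚ (q ^ k) ℚ.* ℕ→ℚ (q ^ D)) ℚ.* x)
      ≡⟨ regroup (ℕ→ℚ F) (ℕ→ℚ (q ^ k)) (ℕ→ℚ (q ^ D)) x ⟩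
    ℕ→ℚ (q ^ D) ℚ.* ((ℕ→ℚ (q ^ k) ℚ.* ℕ→ℚ F) ℚ.* x)
      ≡⟨ cong (λ y → ℕ→ℚ (q ^ D) ℚ.* (y ℚ.* x)) (ℕ→ℚ-* (q ^ k) F) ⟨
    ℕ→ℚ (q ^ D) ℚ.* (ℕ→ℚ (q ^ k * F) ℚ.* x)
      ≡⟨ cong (ℕ→ℚ (q ^ D) ℚ.*_) qᵏF·x≡T ⟩
    ℕ→ℚ (q ^ D) ℚ.* ℤ→ℚ T
      ≡⟨ ℤ→ℚ-* (+ (q ^ D)) T ⟨
    ℤ→ℚ (+ (q ^ D) ℤ.* T)
      ≡⟨ cong ℤ→ℚ qᴰT≡Fz ⟩
    ℤ→ℚ (+ F ℤ.* z)
      ≡⟨ ℤ→ℚ-* (+ F) z ⟩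
    ℕ→ℚ F ℚ.* ℤ→ℚ z ∎)
  where
  open ≡-Reasoning
  z : ℤ
  z = + (q ^ (D ∸ E)) ℤ.* Z
  regroup : ∀ F a b x → F ℚ.* ((a ℚ.* b) ℚ.* x) ≡ b ℚ.* ((a ℚ.* F) ℚ.* x)
  regroup = solve-∀ ℚ-ring
  regroupℤ : ∀ a b Z m → (a ℤ.* b) ℤ.* (Z ℤ.* m) ≡ (m ℤ.* b) ℤ.* (a ℤ.* Z)
  regroupℤ = ℤ-solve
  qᴰT≡Fz : + (q ^ D) ℤ.* T ≡ + F ℤ.* z
  qᴰT≡Fz = begin
    + (q ^ D) ℤ.* T
      ≡⟨ cong₂ ℤ._*_ (trans (cong (λ d → + (q ^ d)) (sym (ℕP.m∸n+n≡m E≤D)))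
           (trans (cong +_ (ℕP.^-distribˡ-+-* q (D ∸ E) E)) (ℤP.pos-* (q ^ (D ∸ E)) (q ^ E)))) T≡Zμ ⟩
    (+ (q ^ (D ∸ E)) ℤ.* + (q ^ E)) ℤ.* (Z ℤ.* + μ)
      ≡⟨ regroupℤ (+ (q ^ (D ∸ E))) (+ (q ^ E)) Z (+ μ) ⟩
    (+ μ ℤ.* + (q ^ E)) ℤ.* z
      ≡⟨ cong (ℤ._* z) (sym (trans (cong +_ F≡μqᴱ) (ℤP.pos-* μ (q ^ E)))) ⟩
    + F ℤ.* z ∎

abs-transfer : ∀ M .{{_ : NonZero M}} x T B → ℕ→ℚ M ℚ.* x ≡ ℤ→ℚ T → ℤ.∣ T ∣ ≤ M * B → ℚ.∣ x ∣ ℚ.≤ ℕ→ℚ B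
abs-transfer M x T B M·x≡T ∣T∣≤MB = ℚP.*-cancelʳ-≤-pos (ℕ→ℚ M) {{ℕ→ℚ-positive M}} (begin
    ℚ.∣ x ∣ ℚ.* ℕ→ℚ M            ≡⟨ cong (ℚ.∣ x ∣ ℚ.*_) (ℤ→ℚ-∣∣ (+ M)) ⟨
    ℚ.∣ x ∣ ℚ.* ℚ.∣ ℕ→ℚ M ∣      ≡⟨ ℚP.∣p*q∣≡∣p∣*∣q∣ x (ℕ→ℚ M) ⟨
    ℚ.∣ x ℚ.* ℕ→ℚ M ∣            ≡⟨ cong ℚ.∣_∣ (trans (ℚP.*-comm x (ℕ→ℚ M)) M·x≡T) ⟩
    ℚ.∣ ℤ→ℚ T ∣                  ≡⟨ ℤ→ℚ-∣∣ T ⟩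
    ℕ→ℚ ℤ.∣ T ∣                  ≤⟨ ℤ→ℚ-mono-≤ (ℤ.+≤+ ∣T∣≤MB) ⟩
    ℕ→ℚ (M * B)                  ≡⟨ cong ℕ→ℚ (ℕP.*-comm M B) ⟩
    ℕ→ℚ (B * M)                  ≡⟨ ℕ→ℚ-* B M ⟩
    ℕ→ℚ B ℚ.* ℕ→ℚ M              ∎)
  where open ℚP.≤-Reasoning

-- The hypotheses of the theorem exclude a = q - 1: then a (r-1) + (s-1) ≡ s - r (mod q).
q∤a+1 : ∀ q a r′ s′ → r′ ≤ s′ → a < q → q ∣ a * r′ + s′ → q ∤ (s′ ∸ r′) → q ∤ a + 1
q∤a+1 q a r′ s′ r′≤s′ a<q q∣ar′+s′ q∤s′-r′ q∣a+1 =
  q∤s′-r′ (ND.∣m+n∣m⇒∣n (subst (q ∣_) split q∣ar′+s′) (ND.m∣m*n r′))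
  where
  a+1≡q : a + 1 ≡ q
  a+1≡q = ℕP.≤-antisym (subst (_≤ q) (ℕP.+-comm 1 a) a<q)
            (subst (q ≤_) (ℕP.+-comm 1 a) (ND.∣⇒≤ (subst (q ∣_) (ℕP.+-comm a 1) q∣a+1)))
  regroup : ∀ a r d → a * r + (r + d) ≡ (a + 1) * r + d
  regroup = ℕ-solve
  split : a * r′ + s′ ≡ q * r′ + (s′ ∸ r′)
  split = begin
    a * r′ + s′                ≡⟨ cong (λ z → a * r′ + z) (ℕP.m+[n∸m]≡n r′≤s′) ⟨
    a * r′ + (r′ + (s′ ∸ r′))  ≡⟨ regroup a r′ (s′ ∸ r′) ⟩
    (a + 1) * r′ + (s′ ∸ r′)   ≡⟨ cong (λ z → z * r′ + (s′ ∸ r′)) a+1≡q ⟩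
    q * r′ + (s′ ∸ r′)         ∎
    where open ≡-Reasoning

lemma3 : (q r s a : ℕ) .{{_ : NonZero q}} → Prime q →
    3 ≤ r → r < s →
    ¬ (q ∣ (r ∸ 1)) → ¬ (q ∣ (s ∸ 1)) → ¬ (q ∣ (s ∸ r)) →
    0 < a → a < q → q ∣ (a * (r ∸ 1) + (s ∸ 1)) →
    (n : ℕ) →
      let an = coeff ((+ a) ℚ./ q) ((+ 1) ℚ./ q) (ℚ.- ((+ (a + 1)) ℚ./ q)) r s n in
      ((e : ℤ) → IsOrd q (ℕ→ℚ (n !)) e → IsOrd q an (ℤ.- (+ n) ℤ.- e))
      × (Σ ℤ λ z → ℕ→ℚ (q ℕ.^ (n + fdiv n (q ∸ 1))) ℚ.* an ≡ (z ℚ./ 1))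
      × (ℚ.∣ an ∣ ℚ.≤ ℕ→ℚ ((fdiv n r + 1) * (fdiv n s + 1)))
lemma3 zero _ _ _ _ _ _ _ _ _ _ () _ _
lemma3 (suc zero) _ _ _ q-prime = ⊥-elim (ℕP.<-irrefl refl (PrimeFacts.1<q 1 q-prime))
lemma3 q@(suc (suc q₂)) r@(suc r′) s@(suc s′) a q-prime 3≤r (s≤s r≤s′) _ _ q∤s-r _ a<q q∣a[r-1]+[s-1] n =
  ord-aₙ , integral-aₙ , bound-aₙ
  where
  open PrimeFacts q q-prime using (legendre; ∤⇒coprime)
  γq≡-[a+1] : ℚ.- ((+ (a + 1)) / q) ℚ.* ℕ→ℚ q ≡ ℤ→ℚ (ℤ.- (+ (a + 1)))
  γq≡-[a+1] = trans (sym (ℚP.neg-distribˡ-* ((+ (a + 1)) / q) (ℕ→ℚ q)))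
                (trans (cong ℚ.-_ (/-*-denominator (+ (a + 1)) q)) (sym (ℤ→ℚ-neg (+ (a + 1)))))
  open Coefficient q r s n ((+ a) / q) (1ℤ / q) (ℚ.- ((+ (a + 1)) / q)) (+ a) 1ℤ (ℤ.- (+ (a + 1)))
         (/-*-denominator (+ a) q) (/-*-denominator 1ℤ q) γq≡-[a+1]
  2≤r : 2 ≤ r
  2≤r = ℕP.≤-trans (ℕP.n≤1+n 2) 3≤r
  2≤s : 2 ≤ s
  2≤s = ℕP.≤-trans 2≤r (s≤s (ℕP.<⇒≤ r≤s′))
  q∤u₃ : q ∤ ℤ.∣ ℤ.- (+ (a + 1)) ∣
  q∤u₃ = subst (q ∤_) (sym (ℤP.∣-i∣≡∣i∣ (+ (a + 1))))
           (q∤a+1 q a r′ s′ (ℕP.≤-trans (ℕP.n≤1+n r′) r≤s′) a<q q∣a[r-1]+[s-1] q∤s-r)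

  ord-aₙ : (e : ℤ) → IsOrd q (ℕ→ℚ (n !)) e → IsOrd q (coeff _ _ _ r s n) (ℤ.- (+ n) ℤ.- e)
  ord-aₙ e = ord-transfer q q-prime n (n !) {{ℕP._!≢0 n}} _ T e M·aₙ≡T (q∤T q-prime 2≤r 2≤s q∤u₃)

  integral-aₙ : Σ ℤ λ z → ℕ→ℚ (q ^ (n + n ℕ./ suc q₂)) ℚ.* coeff _ _ _ r s n ≡ ℤ→ℚ z
  integral-aₙ with legendre n
  ... | μ , E , n!≡μqᴱ , q∤μ , E[q-1]≤n =
    integral-transfer q n (n !) {{ℕP._!≢0 n}} μ E (n ℕ./ suc q₂) _ T M·aₙ≡T n!≡μqᴱ
      (μ∣T μ {{μ≢0}} (∤⇒coprime q∤μ) (ND.divides (q ^ E) (trans n!≡μqᴱ (ℕP.*-comm μ (q ^ E)))))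
      (subst (_≤ n ℕ./ suc q₂) (ℕD.m*n/n≡m E (suc q₂)) (ℕD./-monoˡ-≤ (suc q₂) E[q-1]≤n))
    where
    μ≢0 : NonZero μ
    μ≢0 = ℕP.m*n≢0⇒m≢0 μ {{subst NonZero n!≡μqᴱ (ℕP._!≢0 n)}}

  bound-aₙ : ℚ.∣ coeff _ _ _ r s n ∣ ℚ.≤ ℕ→ℚ ((n ℕ./ r + 1) * (n ℕ./ s + 1))
  bound-aₙ = abs-transfer M {{ℕP.m*n≢0 (q ^ n) (n !) {{ℕP.m^n≢0 q n}} {{ℕP._!≢0 n}}}} _ T _ M·aₙ≡T
    (subst (ℤ.∣ T ∣ ≤_) (ℕP.*-assoc M (n ℕ./ r + 1) (n ℕ./ s + 1))
      (∣T∣≤ (ℕP.<⇒≤ a<q) (s≤s z≤n) (subst (_≤ q) (sym (ℤP.∣-i∣≡∣i∣ (+ (a + 1)))) (subst (_≤ q) (ℕP.+-comm 1 a) a<q))))
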